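{- Let $r,c,v\ge 2$ be integers and let $e,\lambda_{rc},\lambda_{rr},\lambda_{cc},\mu$ be the numbers associated to the parameter set $(r\times c, v)$ as described in the context. Define \[ S_{\mathrm{NTA}} := S\Big(\binom{c}{2}, \lambda_{cc}\Big) + S\Big(\binom{r}{2}, \lambda_{rr}\Big) + S(rc, \lambda_{rc}),\qquad S_{\mathrm{NBG}} := S\Big(\binom{v}{2}, \mu\Big). \] Then: (a) if $S_{\mathrm{NTA}} < S_{\mathrm{NBG}}$, there is no $(r\times c,v)$-near triple array; (b) if $S_{\mathrm{NTA}} > S_{\mathrm{NBG}}$, there is no $(r\times c,v)$-near balanced grid; (c) if $S_{\mathrm{NTA}} = S_{\mathrm{NBG}}$, then every $(r\times c,v)$-near triple array is an $(r\times c,v)$-near balanced grid and every $(r\times c,v)$-near balanced grid is an $(r\times c,v)$-near triple array.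
   Context: For a real $x$ write $x^-=\lfloor x\rfloor$, $x^+=\lceil x\rceil$, and $\binom{x}{2}=x(x-1)/2$. For an integer $n$ and real $m$, $S(n,m) := n\binom{m}{2} + \frac{n(m-m^-)(m^+-m)}{2}$. Parameters of $(r\times c,v)$: $e=rc/v$, $\lambda_{rc}= e^-+e^+-\frac{e^-e^+}{e}$, $\lambda_{rr}=\frac{c(\lambda_{rc}-1)}{r-1}$, $\lambda_{cc}=\frac{r(\lambda_{rc}-1)}{c-1}$, $\mu=\frac{\binom{c}{2}r+\binom{r}{2}c}{\binom{v}{2}}=\frac{e(r+c-2)}{v-1}$. An $r\times c$ row-column design on $v$ symbols is an $r\times c$ array each of whose cells holds one of $v$ symbols; it is binary if no symbol occurs twice in a row or in a column; it is equireplicate if $e$ is an integer and each symbol occurs exactly $e$ times, and near equireplicate if $e$ is not an integer and each symbol occurs $e^-$ or $e^+$ times. For a binary design, with $R_i$, $C_j$ the symbol sets of row $i$ and column $j$, let $\bar\lambda_{rc}$, $\bar\lambda_{rr}$, $\bar\lambda_{cc}$ be the averages of $|R_i\cap C_j|$ over all row–column pairs, of $|R_i\cap R_j|$ over pairs of distinct rows, and of $|C_i\cap C_j|$ over pairs of distinct columns. An $(r\times c,v)$-near triple array is a binary equireplicate or near equireplicate $r\times c$ design on $v$ symbols in which every row and column share $\bar\lambda_{rc}^-$ or $\bar\lambda_{rc}^+$ symbols, every two distinct rows share $\bar\lambda_{rr}^-$ or $\bar\lambda_{rr}^+$ symbols, and every two distinct columns share $\bar\lambda_{cc}^-$ or $\bar\lambda_{cc}^+$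 symbols. An $(r\times c,v)$-near balanced grid is a binary equireplicate or near equireplicate $r\times c$ design on $v$ symbols in which, for each pair of distinct symbols, the number of rows plus the number of columns containing both symbols is $\mu^-$ or $\mu^+$. -}

module Defs where

open import Data.Nat as ℕ using (ℕ; zero; suc)
open import Data.Nat.Combinatorics using (_C_)
open import Data.Integer as ℤ using (ℤ; +_)
open import Data.Rational as ℚ using (ℚ; floor; ceiling; ½; 0ℚ; 1ℚ)
open import Data.Fin as Fin using (Fin; toℕ)
open import Data.Bool using (Bool; true; false; _∧_; _∨_; if_then_else_)
open import Relation.Nullary using (does)
open import Relation.Binary.PropositionalEquality using (_≡_; _≢_)
open import Data.Sum using (_⊎_)
open import Data.Product using (_×_)

ℕtoℚ : ℕ → ℚ
ℕtoℚ n = (+ n) ℚ./ 1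

-- division of an integer by a natural; the denominator is always nonzero
-- where it is used (r, c, v ≥ 2), the zero case is an arbitrary total default
divℕ : ℤ → ℕ → ℚ
divℕ a zero    = 0ℚ
divℕ a (suc n) = a ℚ./ suc n

lo hi : ℚ → ℚ
lo x = floor x ℚ./ 1
hi x = ceiling x ℚ./ 1

binom2 : ℚ → ℚ
binom2 x = x ℚ.* (x ℚ.- 1ℚ) ℚ.* ½

S : ℕ → ℚ → ℚ
S n m = ℕtoℚ n ℚ.* binom2 m ℚ.+ ℕtoℚ n ℚ.* (m ℚ.- lo m) ℚ.* (hi m ℚ.- m) ℚ.* ½

eP : ℕ → ℕ → ℕ → ℚ
eP r c v = divℕ (+ (r ℕ.* c)) v

-- λ_rc = e^- + e^+ - e^- e^+ / e, with 1/e = v/(rc)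
λrcP : ℕ → ℕ → ℕ → ℚ
λrcP r c v = lo e ℚ.+ hi e ℚ.- lo e ℚ.* hi e ℚ.* divℕ (+ v) (r ℕ.* c)
  where e = eP r c v

λrrP : ℕ → ℕ → ℕ → ℚ
λrrP r c v = ℕtoℚ c ℚ.* (λrcP r c v ℚ.- 1ℚ) ℚ.* divℕ (+ 1) (r ℕ.∸ 1)

λccP : ℕ → ℕ → ℕ → ℚ
λccP r c v = ℕtoℚ r ℚ.* (λrcP r c v ℚ.- 1ℚ) ℚ.* divℕ (+ 1) (c ℕ.∸ 1)

μP : ℕ → ℕ → ℕ → ℚ
μP r c v = eP r c v ℚ.* ℕtoℚ (r ℕ.+ c ℕ.∸ 2) ℚ.* divℕ (+ 1) (v ℕ.∸ 1)

S-NTA S-NBG : ℕ → ℕ → ℕ → ℚ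
S-NTA r c v = S (c C 2) (λccP r c v) ℚ.+ S (r C 2) (λrrP r c v) ℚ.+ S (r ℕ.* c) (λrcP r c v)
S-NBG r c v = S (v C 2) (μP r c v)

countF : ∀ {n} → (Fin n → Bool) → ℕ
countF {zero}  p = 0
countF {suc n} p = (if p Fin.zero then 1 else 0) ℕ.+ countF (λ i → p (Fin.suc i))

anyF : ∀ {n} → (Fin n → Bool) → Bool
anyF {zero}  p = false
anyF {suc n} p = p Fin.zero ∨ anyF (λ i → p (Fin.suc i))

sumF : ∀ {n} → (Fin n → ℕ) → ℕ
sumF {zero}  f = 0
sumF {suc n} f = f Fin.zero ℕ.+ sumF (λ i → f (Fin.suc i))

Design : ℕ → ℕ → ℕ → Set
Design r c v = Fin r → Fin c → Fin v

module _ {r c v : ℕ} (d : Design r c v) where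

  inRow : Fin r → Fin v → Bool
  inRow i s = anyF (λ k → does (d i k Fin.≟ s))

  inCol : Fin c → Fin v → Bool
  inCol j s = anyF (λ k → does (d k j Fin.≟ s))

  occ : Fin v → ℕ
  occ s = sumF (λ i → countF (λ j → does (d i j Fin.≟ s)))

  Binary : Set
  Binary = (∀ i j j' → d i j ≡ d i j' → j ≡ j')
         × (∀ j i i' → d i j ≡ d i' j → i ≡ i')

  -- equireplicate (e integer: e^- = e^+ = e) or near equireplicate
  EqOrNearEq : Set
  EqOrNearEq = ∀ s → (+ occ s ≡ floor (eP r c v)) ⊎ (+ occ s ≡ ceiling (eP r c v))

  rcI : Fin r → Fin c → ℕ
  rcI i j = countF (λ s → inRow i s ∧ inCol j s)

  rrI : Fin r → Fin r → ℕ
  rrI i i' = countF (λ s → inRow i s ∧ inRow i' s)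

  ccI : Fin c → Fin c → ℕ
  ccI j j' = countF (λ s → inCol j s ∧ inCol j' s)

  avgRC : ℚ
  avgRC = divℕ (+ sumF (λ i → sumF (λ j → rcI i j))) (r ℕ.* c)

  avgRR : ℚ
  avgRR = divℕ (+ sumF (λ i → sumF (λ i' → if does (toℕ i ℕ.<? toℕ i') then rrI i i' else 0))) (r C 2)

  avgCC : ℚ
  avgCC = divℕ (+ sumF (λ j → sumF (λ j' → if does (toℕ j ℕ.<? toℕ j') then ccI j j' else 0))) (c C 2)

  InFloorCeil : ℕ → ℚ → Set
  InFloorCeil n x = (+ n ≡ floor x) ⊎ (+ n ≡ ceiling x)

  NearTripleArray : Set
  NearTripleArray = Binary × EqOrNearEq
    × (∀ i j → InFloorCeil (rcI i j) avgRC)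
    × (∀ i i' → i ≢ i' → InFloorCeil (rrI i i') avgRR)
    × (∀ j j' → j ≢ j' → InFloorCeil (ccI j j') avgCC)

  NearBalancedGrid : Set
  NearBalancedGrid = Binary × EqOrNearEq
    × (∀ s t → s ≢ t →
         InFloorCeil (countF (λ i → inRow i s ∧ inRow i t) ℕ.+ countF (λ j → inCol j s ∧ inCol j t))
                     (μP r c v))

{-# OPTIONS --safe #-}
module Submission where

-- Write a = ⌊T/N⌋ for a family of N naturals with sum T. The binomial n ↦ n C 2 lies above its
-- chord through a and a + 1, so the sum of x C 2 over the family is at least the sum of the chord,
-- which is N (a C 2) + (T mod N) a = S(N, T/N), with equality exactly when every member is ⌊T/N⌋
-- or ⌈T/N⌉. Counting the pairs of symbols lying together in pairs of lines (rows or columns) of an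
-- array shows that, for any array, the sums of |R ∩ R'| C 2 over pairs of rows, |C ∩ C'| C 2 over
-- pairs of columns and |R ∩ C| C 2 over rows and columns add up to the sum of μ_st C 2 over pairs
-- of symbols. For a binary (near-)equireplicate array the parameters λ_cc, λ_rr, λ_rc and μ are
-- the averages of the four families, so both S_NTA and S_NBG bound this common number from below;
-- the first bound is attained exactly by near triple arrays, the second exactly by near balanced
-- grids, and (a), (b), (c) follow.

open import Data.Nat.Properties
open import Algebra.Properties.Semiring.Sum +-*-semiring
  using (sum; sum-syntax; sum-cong-≗; ∑-distrib-+; ∑-comm; *-distribˡ-sum; *-distribʳ-sum)
open import Data.Bool.Base using (Bool; true; false; _∧_; if_then_else_; T)
open import Data.Bool.Properties using (∧-comm; ∧-idem)
open import Data.Fin.Base using (Fin; zero; suc; toℕ)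
import Data.Fin.Properties as Fin
open import Data.Integer.Base as ℤ using (ℤ; +_; -[1+_])
import Data.Integer.DivMod as ℤ
import Data.Integer.Properties as ℤ
open import Data.Nat.Base as ℕ using (ℕ; zero; suc; _+_; _*_; _∸_; _≤_; z≤n; s≤s; NonZero; _/_; _%_)
open import Data.Nat.Combinatorics using (_C_; nC1≡n; nCk+nC[k+1]≡[n+1]C[k+1])
open import Data.Nat.Coprimality as Coprime using (1-coprimeTo)
open import Data.Nat.DivMod using (m≡m%n+[m/n]*n; m*n/m*o≡n/o; /-congˡ; /-congʳ)
open import Data.Nat.Tactic.RingSolver using (solve-∀)
open import Data.Product.Base using (_×_; _,_; proj₁; proj₂; ∃; ∃-syntax)
open import Data.Rational.Base as ℚ using (ℚ; mkℚ; floor; ceiling; ½; 1ℚ; toℚᵘ; _<_)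
import Data.Rational.Properties as ℚ
open import Data.Rational.Solver using (module +-*-Solver)
open import Data.Rational.Unnormalised.Base as ℚᵘ using (mkℚᵘ; *≡*)
import Data.Rational.Unnormalised.Properties as ℚᵘ
open import Data.Sum.Base using (_⊎_; inj₁; inj₂)
open import Function.Base using (_∘_)
open import Function.Bundles using (_⇔_; mk⇔; Equivalence)
open import Function.Construct.Composition using (_⇔-∘_)
open import Relation.Binary.Definitions using (tri<; tri≈; tri>)
open import Relation.Binary.PropositionalEquality
open import Relation.Nullary.Decidable using (dec-true)
open import Relation.Nullary.Decidable.Core using (Dec; does; yes; no)
open import Relation.Nullary.Negation.Core using (¬_; contradiction)

open import Defs

open ≡-Reasoning

private variable a b m n : ℕ

sumF≡∑ : (f : Fin n → ℕ) → sumF f ≡ ∑[ i < n ] f i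
sumF≡∑ {zero}  f = refl
sumF≡∑ {suc n} f = cong (λ y → f zero + y) (sumF≡∑ (f ∘ suc))

sumF²≡∑∑ : (f : Fin m → Fin n → ℕ) → sumF (λ i → sumF (f i)) ≡ ∑[ i < m ] ∑[ j < n ] f i j
sumF²≡∑∑ f = trans (sumF≡∑ (λ i → sumF (f i))) (sum-cong-≗ (λ i → sumF≡∑ (f i)))

⟦_⟧ : Bool → ℕ
⟦ b ⟧ = if b then 1 else 0

countF≡∑ : (p : Fin n → Bool) → countF p ≡ ∑[ i < n ] ⟦ p i ⟧
countF≡∑ {zero}  p = refl
countF≡∑ {suc n} p = cong (λ y → ⟦ p zero ⟧ + y) (countF≡∑ (p ∘ suc))

⟦∧⟧ : ∀ a b → ⟦ a ∧ b ⟧ ≡ ⟦ a ⟧ * ⟦ b ⟧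
⟦∧⟧ true  b = sym (+-identityʳ ⟦ b ⟧)
⟦∧⟧ false b = refl

∑-const : ∀ n k → ∑[ i < n ] k ≡ n * k
∑-const zero    k = refl
∑-const (suc n) k = cong (λ y → k + y) (∑-const n k)

∑-mono-≤ : {f g : Fin n → ℕ} → (∀ i → f i ≤ g i) → sum f ≤ sum g
∑-mono-≤ {zero}  f≤g = z≤n
∑-mono-≤ {suc n} f≤g = +-mono-≤ (f≤g zero) (∑-mono-≤ (f≤g ∘ suc))

+-mono-≤-≡⇒≡ : ∀ {a b c d} → a ≤ c → b ≤ d → a + b ≡ c + d → a ≡ c × b ≡ d
+-mono-≤-≡⇒≡ {a} {b} {c} {d} a≤c b≤d eq = ≤-antisym a≤c c≤a , ≤-antisym b≤d d≤b
  where
  c≤a : c ≤ a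
  c≤a = +-cancelʳ-≤ b c a (≤-trans (+-monoʳ-≤ c b≤d) (≤-reflexive (sym eq)))
  d≤b : d ≤ b
  d≤b = +-cancelˡ-≤ a d b (≤-trans (+-monoˡ-≤ d a≤c) (≤-reflexive (sym eq)))

∑-mono-≤-≡⇒≡ : {f g : Fin n → ℕ} → (∀ i → f i ≤ g i) → sum f ≡ sum g → ∀ i → f i ≡ g i
∑-mono-≤-≡⇒≡ f≤g eq zero    = proj₁ (+-mono-≤-≡⇒≡ (f≤g zero) (∑-mono-≤ (f≤g ∘ suc)) eq)
∑-mono-≤-≡⇒≡ f≤g eq (suc i) =
  ∑-mono-≤-≡⇒≡ (f≤g ∘ suc) (proj₂ (+-mono-≤-≡⇒≡ (f≤g zero) (∑-mono-≤ (f≤g ∘ suc)) eq)) i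

∑-*-∑ : (f : Fin m → ℕ) (g : Fin n → ℕ) → sum f * sum g ≡ ∑[ i < m ] ∑[ j < n ] (f i * g j)
∑-*-∑ f g = trans (*-distribʳ-sum (sum g) f) (sum-cong-≗ (λ i → *-distribˡ-sum (f i) g))

Selection : ℕ → ℕ → Set
Selection m n = Fin m → Fin n → Bool

restrict : Selection m n → (Fin m → Fin n → ℕ) → Fin m → Fin n → ℕ
restrict sel f i j = if sel i j then f i j else 0

∑⟨_⟩ : Selection m n → (Fin m → Fin n → ℕ) → ℕ
∑⟨_⟩ {m} {n} sel f = ∑[ i < m ] ∑[ j < n ] restrict sel f i j

AllOn : Selection m n → (Fin m → Fin n → Set) → Set
AllOn sel P = ∀ i j → T (sel i j) → P i j

module _ (sel : Selection m n) where

  ∑⟨⟩-cong : {f g : Fin m → Fin n → ℕ} → AllOn sel (λ i j → f i j ≡ g i j) → ∑⟨ sel ⟩ f ≡ ∑⟨ sel ⟩ g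
  ∑⟨⟩-cong {f} {g} f≡g = sum-cong-≗ (λ i → sum-cong-≗ (restrict-cong i))
    where
    restrict-cong : ∀ i j → restrict sel f i j ≡ restrict sel g i j
    restrict-cong i j with sel i j in e
    ... | true  = f≡g i j (subst T (sym e) _)
    ... | false = refl

  restrict-mono : {f g : Fin m → Fin n → ℕ} → AllOn sel (λ i j → f i j ≤ g i j) →
                  ∀ i j → restrict sel f i j ≤ restrict sel g i j
  restrict-mono f≤g i j with sel i j in e
  ... | true  = f≤g i j (subst T (sym e) _)
  ... | false = z≤n

  restrict-injective : {f g : Fin m → Fin n → ℕ} →
                       AllOn sel (λ i j → restrict sel f i j ≡ restrict sel g i j → f i j ≡ g i j)
  restrict-injective i j sel-ij with sel i j
  ... | true = λ eq → eq

  ∑⟨⟩-mono-≤ : {f g : Fin m → Fin n → ℕ} → AllOn sel (λ i j → f i j ≤ g i j) → ∑⟨ sel ⟩ f ≤ ∑⟨ sel ⟩ g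
  ∑⟨⟩-mono-≤ f≤g = ∑-mono-≤ (λ i → ∑-mono-≤ (restrict-mono f≤g i))

  ∑⟨⟩-mono-≤-≡⇒≡ : {f g : Fin m → Fin n → ℕ} → AllOn sel (λ i j → f i j ≤ g i j) →
                   ∑⟨ sel ⟩ f ≡ ∑⟨ sel ⟩ g → AllOn sel (λ i j → f i j ≡ g i j)
  ∑⟨⟩-mono-≤-≡⇒≡ {f} {g} f≤g eq i j sel-ij =
    restrict-injective {f} {g} i j sel-ij (∑-mono-≤-≡⇒≡ (restrict-mono f≤g i) row≡ j)
    where
    row≡ : ∑[ j < n ] restrict sel f i j ≡ ∑[ j < n ] restrict sel g i j
    row≡ = ∑-mono-≤-≡⇒≡ (λ i → ∑-mono-≤ (restrict-mono f≤g i)) eq i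

  ∑⟨⟩-+ : (f g : Fin m → Fin n → ℕ) → ∑⟨ sel ⟩ (λ i j → f i j + g i j) ≡ ∑⟨ sel ⟩ f + ∑⟨ sel ⟩ g
  ∑⟨⟩-+ f g = begin
    ∑[ i < m ] ∑[ j < n ] restrict sel (λ i j → f i j + g i j) i j
      ≡⟨ sum-cong-≗ (λ i → trans (sum-cong-≗ (restrict-+ i)) (∑-distrib-+ (restrict sel f i) (restrict sel g i))) ⟩
    ∑[ i < m ] (∑[ j < n ] restrict sel f i j + ∑[ j < n ] restrict sel g i j)
      ≡⟨ ∑-distrib-+ (λ i → ∑[ j < n ] restrict sel f i j) (λ i → ∑[ j < n ] restrict sel g i j) ⟩
    ∑⟨ sel ⟩ f + ∑⟨ sel ⟩ g ∎
    where
    restrict-+ : ∀ i j → restrict sel (λ i j → f i j + g i j) i j ≡ restrict sel f i j + restrict sel g i j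
    restrict-+ i j with sel i j
    ... | true  = refl
    ... | false = refl

  ∑⟨⟩-*ˡ : (k : ℕ) (f : Fin m → Fin n → ℕ) → ∑⟨ sel ⟩ (λ i j → k * f i j) ≡ k * ∑⟨ sel ⟩ f
  ∑⟨⟩-*ˡ k f = begin
    ∑[ i < m ] ∑[ j < n ] restrict sel (λ i j → k * f i j) i j
      ≡⟨ sum-cong-≗ (λ i → trans (sum-cong-≗ (restrict-*ˡ i)) (sym (*-distribˡ-sum k (restrict sel f i)))) ⟩
    ∑[ i < m ] (k * ∑[ j < n ] restrict sel f i j)
      ≡⟨ sym (*-distribˡ-sum k (λ i → ∑[ j < n ] restrict sel f i j)) ⟩
    k * ∑⟨ sel ⟩ f ∎
    where
    restrict-*ˡ : ∀ i j → restrict sel (λ i j → k * f i j) i j ≡ k * restrict sel f i j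
    restrict-*ˡ i j with sel i j
    ... | true  = refl
    ... | false = sym (*-zeroʳ k)

full : Selection m n
full _ _ = true

∑⟨full⟩-1 : ∀ m n → ∑⟨ full {m} {n} ⟩ (λ _ _ → 1) ≡ m * n
∑⟨full⟩-1 m n = trans (sum-cong-≗ row) (∑-const m n)
  where
  row : (i : Fin m) → ∑[ j < n ] 1 ≡ n
  row _ = trans (∑-const n 1) (*-identityʳ n)

-- Unordered pairs {i, j} as i < j, by the same test as in avgRR.
ascending : Selection n n
ascending i j = does (toℕ i <? toℕ j)

∑∑-symmetric : (f : Fin n → Fin n → ℕ) → (∀ i j → f i j ≡ f j i) →
               ∑[ i < n ] ∑[ j < n ] f i j ≡ ∑[ i < n ] f i i + 2 * ∑⟨ ascending ⟩ f
∑∑-symmetric {zero}  f f-sym = refl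
∑∑-symmetric {suc n} f f-sym = begin
  (f zero zero + row₀) + ∑[ i < n ] (f (suc i) zero + ∑[ j < n ] f (suc i) (suc j))
    ≡⟨ cong (λ y → (f zero zero + row₀) + y) (∑-distrib-+ (λ i → f (suc i) zero) (λ i → ∑[ j < n ] f (suc i) (suc j))) ⟩
  (f zero zero + row₀) + (∑[ i < n ] f (suc i) zero + ∑[ i < n ] ∑[ j < n ] f (suc i) (suc j))
    ≡⟨ cong₂ (λ x y → (f zero zero + row₀) + (x + y))
             (sum-cong-≗ (λ i → f-sym (suc i) zero))
             (∑∑-symmetric (λ i j → f (suc i) (suc j)) (λ i j → f-sym (suc i) (suc j))) ⟩
  (f zero zero + row₀) + (row₀ + (diag + 2 * above))
    ≡⟨ rearrange (f zero zero) row₀ diag above ⟩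
  (f zero zero + diag) + 2 * (row₀ + above) ∎
  where
  row₀ = ∑[ j < n ] f zero (suc j)
  diag = ∑[ i < n ] f (suc i) (suc i)
  above = ∑⟨ ascending ⟩ (λ i j → f (suc i) (suc j))
  rearrange : ∀ a b c d → (a + b) + (b + (c + 2 * d)) ≡ (a + c) + 2 * (b + d)
  rearrange = solve-∀

∑⟨ascending⟩-1≡C2 : ∀ n → ∑⟨ ascending {n} ⟩ (λ _ _ → 1) ≡ n C 2
∑⟨ascending⟩-1≡C2 zero    = refl
∑⟨ascending⟩-1≡C2 (suc n) = begin
  ∑[ j < n ] 1 + ∑⟨ ascending {n} ⟩ (λ _ _ → 1)
    ≡⟨ cong₂ _+_ (trans (∑-const n 1) (*-identityʳ n)) (∑⟨ascending⟩-1≡C2 n) ⟩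
  n + n C 2
    ≡⟨ cong (_+ n C 2) (sym (nC1≡n n)) ⟩
  n C 1 + n C 2
    ≡⟨ nCk+nC[k+1]≡[n+1]C[k+1] n 1 ⟩
  suc n C 2 ∎

module _ {P : Fin n → Fin n → Set} where

  ≢⇒AllOn-ascending : (∀ i j → i ≢ j → P i j) → AllOn ascending P
  ≢⇒AllOn-ascending h i j i<j = h i j (λ i≡j → <-irrefl (cong toℕ i≡j) (<ᵇ⇒< (toℕ i) (toℕ j) i<j))

  AllOn-ascending⇒≢ : (∀ i j → P i j → P j i) → AllOn ascending P → ∀ i j → i ≢ j → P i j
  AllOn-ascending⇒≢ P-sym h i j i≢j with <-cmp (toℕ i) (toℕ j)
  ... | tri< i<j _ _ = h i j (<⇒<ᵇ i<j)
  ... | tri≈ _ i≡j _ = contradiction (Fin.toℕ-injective i≡j) i≢j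
  ... | tri> _ _ j<i = P-sym j i (h j i (<⇒<ᵇ j<i))

∑∑-* : ∀ {a b} (F : Fin a → Fin n → ℕ) (G : Fin b → Fin n → ℕ) →
       ∑[ k < a ] ∑[ l < b ] ∑[ s < n ] (F k s * G l s) ≡ ∑[ s < n ] (∑[ k < a ] F k s * ∑[ l < b ] G l s)
∑∑-* {n} {a} {b} F G = begin
  ∑[ k < a ] ∑[ l < b ] ∑[ s < n ] (F k s * G l s) ≡⟨ sum-cong-≗ (λ k → ∑-comm (λ l s → F k s * G l s)) ⟩
  ∑[ k < a ] ∑[ s < n ] ∑[ l < b ] (F k s * G l s) ≡⟨ ∑-comm (λ k s → ∑[ l < b ] (F k s * G l s)) ⟩
  ∑[ s < n ] ∑[ k < a ] ∑[ l < b ] (F k s * G l s) ≡⟨ sum-cong-≗ (λ s → sym (∑-*-∑ (λ k → F k s) (λ l → G l s))) ⟩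
  ∑[ s < n ] (∑[ k < a ] F k s * ∑[ l < b ] G l s) ∎

∑∑-*-∑∑ : ∀ {a b} (F : Fin a → Fin n → ℕ) (G : Fin b → Fin n → ℕ) →
          ∑[ k < a ] ∑[ l < b ] (∑[ s < n ] (F k s * G l s) * ∑[ t < n ] (F k t * G l t))
          ≡ ∑[ s < n ] ∑[ t < n ] (∑[ k < a ] (F k s * F k t) * ∑[ l < b ] (G l s * G l t))
∑∑-*-∑∑ {n} {a} {b} F G = begin
  ∑[ k < a ] ∑[ l < b ] (∑[ s < n ] (F k s * G l s) * ∑[ t < n ] (F k t * G l t))
    ≡⟨ sum-cong-≗ (λ k → sum-cong-≗ (λ l → ∑-*-∑ (λ s → F k s * G l s) (λ t → F k t * G l t))) ⟩
  ∑[ k < a ] ∑[ l < b ] ∑[ s < n ] ∑[ t < n ] ((F k s * G l s) * (F k t * G l t))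
    ≡⟨ sum-cong-≗ (λ k → sum-cong-≗ (λ l → sum-cong-≗ (λ s → sum-cong-≗ (λ t → interchange (F k s) (G l s) (F k t) (G l t))))) ⟩
  ∑[ k < a ] ∑[ l < b ] ∑[ s < n ] ∑[ t < n ] X k l s t
    ≡⟨ sum-cong-≗ (λ k → ∑-comm (λ l s → ∑[ t < n ] X k l s t)) ⟩
  ∑[ k < a ] ∑[ s < n ] ∑[ l < b ] ∑[ t < n ] X k l s t
    ≡⟨ ∑-comm (λ k s → ∑[ l < b ] ∑[ t < n ] X k l s t) ⟩
  ∑[ s < n ] ∑[ k < a ] ∑[ l < b ] ∑[ t < n ] X k l s t
    ≡⟨ sum-cong-≗ (λ s → sum-cong-≗ (λ k → ∑-comm (λ l t → X k l s t))) ⟩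
  ∑[ s < n ] ∑[ k < a ] ∑[ t < n ] ∑[ l < b ] X k l s t
    ≡⟨ sum-cong-≗ (λ s → ∑-comm (λ k t → ∑[ l < b ] X k l s t)) ⟩
  ∑[ s < n ] ∑[ t < n ] ∑[ k < a ] ∑[ l < b ] X k l s t
    ≡⟨ sum-cong-≗ (λ s → sum-cong-≗ (λ t → sym (∑-*-∑ (λ k → F k s * F k t) (λ l → G l s * G l t)))) ⟩
  ∑[ s < n ] ∑[ t < n ] (∑[ k < a ] (F k s * F k t) * ∑[ l < b ] (G l s * G l t)) ∎
  where
  X : Fin a → Fin b → Fin n → Fin n → ℕ
  X k l s t = (F k s * F k t) * (G l s * G l t)
  interchange : ∀ w x y z → (w * x) * (y * z) ≡ (w * y) * (x * z)
  interchange = solve-∀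

-- Incidence structures

_ᵀ : {A : Set} → (Fin a → Fin b → A) → Fin b → Fin a → A
(F ᵀ) j i = F i j

meet : (Fin a → Fin n → Bool) → (Fin b → Fin n → Bool) → Fin a → Fin b → ℕ
meet F G k l = countF (λ s → F k s ∧ G l s)

meet≡∑ : (F : Fin a → Fin n → Bool) (G : Fin b → Fin n → Bool) →
         ∀ k l → meet F G k l ≡ ∑[ s < n ] (⟦ F k s ⟧ * ⟦ G l s ⟧)
meet≡∑ F G k l = trans (countF≡∑ (λ s → F k s ∧ G l s)) (sum-cong-≗ (λ s → ⟦∧⟧ (F k s) (G l s)))

module _ (F : Fin a → Fin n → Bool) where

  meet-diag : ∀ k → meet F F k k ≡ countF (F k)
  meet-diag k = trans (countF≡∑ (λ s → F k s ∧ F k s))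
    (trans (sum-cong-≗ (λ s → cong ⟦_⟧ (∧-idem (F k s)))) (sym (countF≡∑ (F k))))

  module _ (G : Fin b → Fin n → Bool) where

    meet-comm : ∀ k l → meet F G k l ≡ meet G F l k
    meet-comm k l = trans (countF≡∑ (λ s → F k s ∧ G l s))
      (trans (sum-cong-≗ (λ s → cong ⟦_⟧ (∧-comm (F k s) (G l s)))) (sym (countF≡∑ (λ s → G l s ∧ F k s))))

    ∑∑-meet : ∑[ k < a ] ∑[ l < b ] meet F G k l ≡ ∑[ s < n ] (countF ((F ᵀ) s) * countF ((G ᵀ) s))
    ∑∑-meet = begin
      ∑[ k < a ] ∑[ l < b ] meet F G k l
        ≡⟨ sum-cong-≗ (λ k → sum-cong-≗ (meet≡∑ F G k)) ⟩
      ∑[ k < a ] ∑[ l < b ] ∑[ s < n ] (⟦ F k s ⟧ * ⟦ G l s ⟧)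
        ≡⟨ ∑∑-* (λ k s → ⟦ F k s ⟧) (λ l s → ⟦ G l s ⟧) ⟩
      ∑[ s < n ] (∑[ k < a ] ⟦ F k s ⟧ * ∑[ l < b ] ⟦ G l s ⟧)
        ≡⟨ sum-cong-≗ (λ s → sym (cong₂ _*_ (countF≡∑ ((F ᵀ) s)) (countF≡∑ ((G ᵀ) s)))) ⟩
      ∑[ s < n ] (countF ((F ᵀ) s) * countF ((G ᵀ) s)) ∎

    ∑∑-meet² : ∑[ k < a ] ∑[ l < b ] (meet F G k l * meet F G k l)
               ≡ ∑[ s < n ] ∑[ t < n ] (meet (F ᵀ) (F ᵀ) s t * meet (G ᵀ) (G ᵀ) s t)
    ∑∑-meet² = begin
      ∑[ k < a ] ∑[ l < b ] (meet F G k l * meet F G k l)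
        ≡⟨ sum-cong-≗ (λ k → sum-cong-≗ (λ l → cong₂ _*_ (meet≡∑ F G k l) (meet≡∑ F G k l))) ⟩
      _
        ≡⟨ ∑∑-*-∑∑ (λ k s → ⟦ F k s ⟧) (λ l s → ⟦ G l s ⟧) ⟩
      _
        ≡⟨ sum-cong-≗ (λ s → sum-cong-≗ (λ t → sym (cong₂ _*_ (meet≡∑ (F ᵀ) (F ᵀ) s t) (meet≡∑ (G ᵀ) (G ᵀ) s t)))) ⟩
      ∑[ s < n ] ∑[ t < n ] (meet (F ᵀ) (F ᵀ) s t * meet (G ᵀ) (G ᵀ) s t) ∎

suc-C2 : ∀ n → suc n C 2 ≡ n + n C 2
suc-C2 n = trans (sym (nCk+nC[k+1]≡[n+1]C[k+1] n 1)) (cong (_+ n C 2) (nC1≡n n))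

2*C2+n≡n*n : ∀ n → 2 * (n C 2) + n ≡ n * n
2*C2+n≡n*n zero    = refl
2*C2+n≡n*n (suc n) = begin
  2 * (suc n C 2) + suc n         ≡⟨ cong (λ x → 2 * x + suc n) (suc-C2 n) ⟩
  2 * (n + n C 2) + suc n         ≡⟨ regroup n (n C 2) ⟩
  suc (n + n + (2 * (n C 2) + n)) ≡⟨ cong (λ x → suc (n + n + x)) (2*C2+n≡n*n n) ⟩
  suc (n + n + n * n)             ≡⟨ square n ⟩
  suc n * suc n                   ∎
  where
  regroup : ∀ n c → 2 * (n + c) + suc n ≡ suc (n + n + (2 * c + n))
  regroup = solve-∀
  square : ∀ n → suc (n + n + n * n) ≡ suc n * suc n
  square = solve-∀

module _ (sel : Selection m n) (f : Fin m → Fin n → ℕ) where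

  2*∑⟨⟩C2+∑⟨⟩≡∑⟨⟩² : 2 * ∑⟨ sel ⟩ (λ i j → f i j C 2) + ∑⟨ sel ⟩ f ≡ ∑⟨ sel ⟩ (λ i j → f i j * f i j)
  2*∑⟨⟩C2+∑⟨⟩≡∑⟨⟩² = begin
    2 * ∑⟨ sel ⟩ (λ i j → f i j C 2) + ∑⟨ sel ⟩ f   ≡⟨ cong (_+ ∑⟨ sel ⟩ f) (sym (∑⟨⟩-*ˡ sel 2 (λ i j → f i j C 2))) ⟩
    ∑⟨ sel ⟩ (λ i j → 2 * (f i j C 2)) + ∑⟨ sel ⟩ f ≡⟨ sym (∑⟨⟩-+ sel (λ i j → 2 * (f i j C 2)) f) ⟩
    ∑⟨ sel ⟩ (λ i j → 2 * (f i j C 2) + f i j)      ≡⟨ ∑⟨⟩-cong sel (λ i j _ → 2*C2+n≡n*n (f i j)) ⟩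
    ∑⟨ sel ⟩ (λ i j → f i j * f i j)                ∎

4*∑⟨ascending⟩C2 : (f : Fin n → Fin n → ℕ) → (∀ i j → f i j ≡ f j i) →
  4 * ∑⟨ ascending ⟩ (λ i j → f i j C 2) + ∑⟨ full ⟩ f + ∑[ i < n ] (f i i * f i i)
  ≡ ∑⟨ full ⟩ (λ i j → f i j * f i j) + ∑[ i < n ] f i i
4*∑⟨ascending⟩C2 {n} f f-sym = begin
  4 * P₂ + ∑⟨ full ⟩ f + D₂
    ≡⟨ cong (λ x → 4 * P₂ + x + D₂) (∑∑-symmetric f f-sym) ⟩
  4 * P₂ + (D₁ + 2 * P₁) + D₂
    ≡⟨ regroup P₂ P₁ D₁ D₂ ⟩
  2 * (2 * P₂ + P₁) + D₂ + D₁
    ≡⟨ cong (λ x → 2 * x + D₂ + D₁) (2*∑⟨⟩C2+∑⟨⟩≡∑⟨⟩² ascending f) ⟩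
  2 * ∑⟨ ascending ⟩ f² + D₂ + D₁
    ≡⟨ cong (_+ D₁) (trans (+-comm _ D₂) (sym (∑∑-symmetric (λ i j → f i j * f i j) f²-sym))) ⟩
  ∑⟨ full ⟩ f² + D₁ ∎
  where
  P₂ = ∑⟨ ascending ⟩ (λ i j → f i j C 2)
  P₁ = ∑⟨ ascending ⟩ f
  D₁ = ∑[ i < n ] f i i
  D₂ = ∑[ i < n ] (f i i * f i i)
  f² : Fin n → Fin n → ℕ
  f² i j = f i j * f i j
  f²-sym : ∀ i j → f² i j ≡ f² j i
  f²-sym i j = cong₂ _*_ (f-sym i j) (f-sym i j)
  regroup : ∀ p₂ p₁ d₁ d₂ → 4 * p₂ + (d₁ + 2 * p₁) + d₂ ≡ 2 * (2 * p₂ + p₁) + d₂ + d₁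
  regroup = solve-∀

∑-countFᵀ : (F : Fin a → Fin n → Bool) → ∑[ s < n ] countF ((F ᵀ) s) ≡ ∑[ k < a ] countF (F k)
∑-countFᵀ {a} {n} F = begin
  ∑[ s < n ] countF ((F ᵀ) s)     ≡⟨ sum-cong-≗ (λ s → countF≡∑ ((F ᵀ) s)) ⟩
  ∑[ s < n ] ∑[ k < a ] ⟦ F k s ⟧ ≡⟨ ∑-comm (λ s k → ⟦ F k s ⟧) ⟩
  ∑[ k < a ] ∑[ s < n ] ⟦ F k s ⟧ ≡⟨ sum-cong-≗ (λ k → sym (countF≡∑ (F k))) ⟩
  ∑[ k < a ] countF (F k)         ∎

co-occurrence : (Fin a → Fin n → Bool) → (Fin b → Fin n → Bool) → Fin n → Fin n → ℕ
co-occurrence F G s t = meet (F ᵀ) (F ᵀ) s t + meet (G ᵀ) (G ᵀ) s t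

module _ (F : Fin a → Fin n → Bool) (G : Fin b → Fin n → Bool) where

  co-occurrence-sym : ∀ s t → co-occurrence F G s t ≡ co-occurrence F G t s
  co-occurrence-sym s t = cong₂ _+_ (meet-comm (F ᵀ) (F ᵀ) s t) (meet-comm (G ᵀ) (G ᵀ) s t)

  co-occurrence-diag : ∀ s → co-occurrence F G s s ≡ countF ((F ᵀ) s) + countF ((G ᵀ) s)
  co-occurrence-diag s = cong₂ _+_ (meet-diag (F ᵀ) s) (meet-diag (G ᵀ) s)

  ∑∑-co-occurrence : ∑⟨ full ⟩ (co-occurrence F G)
                     ≡ ∑[ k < a ] (countF (F k) * countF (F k)) + ∑[ l < b ] (countF (G l) * countF (G l))
  ∑∑-co-occurrence = trans (∑⟨⟩-+ full (meet (F ᵀ) (F ᵀ)) (meet (G ᵀ) (G ᵀ)))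
                           (cong₂ _+_ (∑∑-meet (F ᵀ) (F ᵀ)) (∑∑-meet (G ᵀ) (G ᵀ)))

  private
    A B co : Fin n → Fin n → ℕ
    A = meet (F ᵀ) (F ᵀ)
    B = meet (G ᵀ) (G ᵀ)
    co = co-occurrence F G

    dF dG : Fin n → ℕ
    dF s = countF ((F ᵀ) s)
    dG s = countF ((G ᵀ) s)

    FF : Fin a → Fin a → ℕ
    FF = meet F F
    GG : Fin b → Fin b → ℕ
    GG = meet G G
    FG : Fin a → Fin b → ℕ
    FG = meet F G

    ∑∑co² : ∑⟨ full ⟩ (λ s t → co s t * co s t)
            ≡ ∑⟨ full ⟩ (λ k k' → FF k k' * FF k k') + ∑⟨ full ⟩ (λ l l' → GG l l' * GG l l')
              + 2 * ∑⟨ full ⟩ (λ k l → FG k l * FG k l)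
    ∑∑co² = begin
      ∑⟨ full ⟩ (λ s t → co s t * co s t)
        ≡⟨ ∑⟨⟩-cong full (λ s t _ → square-+ (A s t) (B s t)) ⟩
      ∑⟨ full ⟩ (λ s t → A s t * A s t + B s t * B s t + 2 * (A s t * B s t))
        ≡⟨ trans (∑⟨⟩-+ full (λ s t → A s t * A s t + B s t * B s t) (λ s t → 2 * (A s t * B s t)))
               (cong₂ _+_ (∑⟨⟩-+ full (λ s t → A s t * A s t) (λ s t → B s t * B s t)) (∑⟨⟩-*ˡ full 2 (λ s t → A s t * B s t))) ⟩
      ∑⟨ full ⟩ (λ s t → A s t * A s t) + ∑⟨ full ⟩ (λ s t → B s t * B s t) + 2 * ∑⟨ full ⟩ (λ s t → A s t * B s t)
        ≡⟨ sym (cong₂ _+_ (cong₂ _+_ (∑∑-meet² F F) (∑∑-meet² G G)) (cong (2 *_) (∑∑-meet² F G))) ⟩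
      ∑⟨ full ⟩ (λ k k' → FF k k' * FF k k') + ∑⟨ full ⟩ (λ l l' → GG l l' * GG l l') + 2 * ∑⟨ full ⟩ (λ k l → FG k l * FG k l) ∎
      where
      square-+ : ∀ x y → (x + y) * (x + y) ≡ x * x + y * y + 2 * (x * y)
      square-+ = solve-∀

    ∑∑co : ∑⟨ full ⟩ co ≡ ∑[ k < a ] (FF k k * FF k k) + ∑[ l < b ] (GG l l * GG l l)
    ∑∑co = trans ∑∑-co-occurrence
      (sym (cong₂ _+_ (sum-cong-≗ (λ k → cong₂ _*_ (meet-diag F k) (meet-diag F k)))
                      (sum-cong-≗ (λ l → cong₂ _*_ (meet-diag G l) (meet-diag G l)))))

    ∑co-diag² : ∑[ s < n ] (co s s * co s s) ≡ ∑⟨ full ⟩ FF + ∑⟨ full ⟩ GG + 2 * ∑⟨ full ⟩ FG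
    ∑co-diag² = begin
      ∑[ s < n ] (co s s * co s s)
        ≡⟨ sum-cong-≗ (λ s → trans (cong (λ x → x * x) (co-occurrence-diag s)) (square-+ (dF s) (dG s))) ⟩
      ∑[ s < n ] (dF s * dF s + dG s * dG s + 2 * (dF s * dG s))
        ≡⟨ trans (∑-distrib-+ (λ s → dF s * dF s + dG s * dG s) (λ s → 2 * (dF s * dG s)))
                 (cong₂ _+_ (∑-distrib-+ (λ s → dF s * dF s) (λ s → dG s * dG s)) (sym (*-distribˡ-sum 2 (λ s → dF s * dG s)))) ⟩
      ∑[ s < n ] (dF s * dF s) + ∑[ s < n ] (dG s * dG s) + 2 * ∑[ s < n ] (dF s * dG s)
        ≡⟨ sym (cong₂ _+_ (cong₂ _+_ (∑∑-meet F F) (∑∑-meet G G)) (cong (2 *_) (∑∑-meet F G))) ⟩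
      ∑⟨ full ⟩ FF + ∑⟨ full ⟩ GG + 2 * ∑⟨ full ⟩ FG ∎
      where
      square-+ : ∀ x y → (x + y) * (x + y) ≡ x * x + y * y + 2 * (x * y)
      square-+ = solve-∀

    ∑co-diag : ∑[ s < n ] co s s ≡ ∑[ k < a ] FF k k + ∑[ l < b ] GG l l
    ∑co-diag = begin
      ∑[ s < n ] co s s                 ≡⟨ trans (sum-cong-≗ co-occurrence-diag) (∑-distrib-+ dF dG) ⟩
      ∑[ s < n ] dF s + ∑[ s < n ] dG s ≡⟨ cong₂ _+_ (∑-countFᵀ F) (∑-countFᵀ G) ⟩
      ∑[ k < a ] countF (F k) + ∑[ l < b ] countF (G l)
        ≡⟨ sym (cong₂ _+_ (sum-cong-≗ (meet-diag F)) (sum-cong-≗ (meet-diag G))) ⟩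
      ∑[ k < a ] FF k k + ∑[ l < b ] GG l l ∎

    X Y₁ Y₂ Y₃ Φ₁F Φ₁G Φ₁H Φ₂F Φ₂G Φ₂H δ₁F δ₁G δ₂F δ₂G E : ℕ
    X  = ∑⟨ ascending ⟩ (λ s t → co s t C 2)
    Y₁ = ∑⟨ ascending ⟩ (λ k k' → FF k k' C 2)
    Y₂ = ∑⟨ ascending ⟩ (λ l l' → GG l l' C 2)
    Y₃ = ∑⟨ full ⟩ (λ k l → FG k l C 2)
    Φ₁F = ∑⟨ full ⟩ FF
    Φ₁G = ∑⟨ full ⟩ GG
    Φ₁H = ∑⟨ full ⟩ FG
    Φ₂F = ∑⟨ full ⟩ (λ k k' → FF k k' * FF k k')
    Φ₂G = ∑⟨ full ⟩ (λ l l' → GG l l' * GG l l')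
    Φ₂H = ∑⟨ full ⟩ (λ k l → FG k l * FG k l)
    δ₁F = ∑[ k < a ] FF k k
    δ₁G = ∑[ l < b ] GG l l
    δ₂F = ∑[ k < a ] (FF k k * FF k k)
    δ₂G = ∑[ l < b ] (GG l l * GG l l)
    E = Φ₁F + δ₂F + Φ₁G + δ₂G + 2 * Φ₁H

    co-side : 4 * X + E ≡ Φ₂F + Φ₂G + 2 * Φ₂H + (δ₁F + δ₁G)
    co-side = begin
      4 * X + E                                               ≡⟨ regroup X Φ₁F δ₂F Φ₁G δ₂G Φ₁H ⟩
      4 * X + (δ₂F + δ₂G) + (Φ₁F + Φ₁G + 2 * Φ₁H)             ≡⟨ sym (cong₂ (λ x y → 4 * X + x + y) ∑∑co ∑co-diag²) ⟩
      4 * X + ∑⟨ full ⟩ co + ∑[ s < n ] (co s s * co s s)     ≡⟨ 4*∑⟨ascending⟩C2 co co-occurrence-sym ⟩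
      ∑⟨ full ⟩ (λ s t → co s t * co s t) + ∑[ s < n ] co s s ≡⟨ cong₂ _+_ ∑∑co² ∑co-diag ⟩
      Φ₂F + Φ₂G + 2 * Φ₂H + (δ₁F + δ₁G)                       ∎
      where
      regroup : ∀ x φF δF φG δG φH →
                4 * x + (φF + δF + φG + δG + 2 * φH) ≡ 4 * x + (δF + δG) + (φF + φG + 2 * φH)
      regroup = solve-∀

    meet-side : 4 * (Y₁ + Y₂ + Y₃) + E ≡ Φ₂F + Φ₂G + 2 * Φ₂H + (δ₁F + δ₁G)
    meet-side = begin
      4 * (Y₁ + Y₂ + Y₃) + E
        ≡⟨ regroup Y₁ Y₂ Y₃ Φ₁F δ₂F Φ₁G δ₂G Φ₁H ⟩
      (4 * Y₁ + Φ₁F + δ₂F) + (4 * Y₂ + Φ₁G + δ₂G) + 2 * (2 * Y₃ + Φ₁H)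
        ≡⟨ cong₂ _+_ (cong₂ _+_ (4*∑⟨ascending⟩C2 FF (meet-comm F F)) (4*∑⟨ascending⟩C2 GG (meet-comm G G)))
                     (cong (2 *_) (2*∑⟨⟩C2+∑⟨⟩≡∑⟨⟩² full FG)) ⟩
      (Φ₂F + δ₁F) + (Φ₂G + δ₁G) + 2 * Φ₂H
        ≡⟨ regroup′ Φ₂F δ₁F Φ₂G δ₁G Φ₂H ⟩
      Φ₂F + Φ₂G + 2 * Φ₂H + (δ₁F + δ₁G) ∎
      where
      regroup : ∀ y₁ y₂ y₃ φF δF φG δG φH →
                4 * (y₁ + y₂ + y₃) + (φF + δF + φG + δG + 2 * φH)
                ≡ (4 * y₁ + φF + δF) + (4 * y₂ + φG + δG) + 2 * (2 * y₃ + φH)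
      regroup = solve-∀
      regroup′ : ∀ φF δF φG δG φH → (φF + δF) + (φG + δG) + 2 * φH ≡ φF + φG + 2 * φH + (δF + δG)
      regroup′ = solve-∀

  -- Both sides count the pairs of points together with a pair of lines through both; the proof
  -- compares four times each side, using the Gram identities ∑∑-meet and ∑∑-meet².
  pair-double-counting :
    ∑⟨ ascending ⟩ (λ s t → co-occurrence F G s t C 2)
    ≡ ∑⟨ ascending ⟩ (λ k k' → meet F F k k' C 2) + ∑⟨ ascending ⟩ (λ l l' → meet G G l l' C 2)
      + ∑⟨ full ⟩ (λ k l → meet F G k l C 2)
  pair-double-counting = *-cancelˡ-≡ X (Y₁ + Y₂ + Y₃) 4 (+-cancelʳ-≡ E _ _ (trans co-side (sym meet-side)))

/-cross : ∀ (i j : ℤ) (m n : ℕ) → i ℤ.* + suc n ≡ j ℤ.* + suc m → i ℚ./ suc m ≡ j ℚ./ suc n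
/-cross i j m n eq = ℚ.fromℚᵘ-cong {mkℚᵘ i m} {mkℚᵘ j n} (*≡* eq)

ℕtoℚ≡mkℚ : ∀ n → ℕtoℚ n ≡ mkℚ (+ n) 0 (Coprime.sym (1-coprimeTo n))
ℕtoℚ≡mkℚ n = ℚ.normalize-coprime (Coprime.sym (1-coprimeTo n))

ℕtoℚ-+ : ∀ m n → ℕtoℚ (m + n) ≡ ℕtoℚ m ℚ.+ ℕtoℚ n
ℕtoℚ-+ m n rewrite ℕtoℚ≡mkℚ m | ℕtoℚ≡mkℚ n =
  /-cross (+ (m + n)) (+ m ℤ.* + 1 ℤ.+ + n ℤ.* + 1) 0 0
          (cong (ℤ._* + 1) (sym (cong₂ ℤ._+_ (ℤ.*-identityʳ (+ m)) (ℤ.*-identityʳ (+ n)))))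

ℕtoℚ-* : ∀ m n → ℕtoℚ (m * n) ≡ ℕtoℚ m ℚ.* ℕtoℚ n
ℕtoℚ-* m n rewrite ℕtoℚ≡mkℚ m | ℕtoℚ≡mkℚ n = /-cross (+ (m * n)) (+ m ℤ.* + n) 0 0 (cong (ℤ._* + 1) (ℤ.pos-* m n))

ℕtoℚ-injective : ∀ {m n} → ℕtoℚ m ≡ ℕtoℚ n → m ≡ n
ℕtoℚ-injective {m} {n} eq rewrite ℕtoℚ≡mkℚ m | ℕtoℚ≡mkℚ n = ℤ.+-injective (cong ℚ.↥_ eq)

ℕtoℚ-cancel-< : ∀ {m n} → ℕtoℚ m ℚ.< ℕtoℚ n → m ℕ.< n
ℕtoℚ-cancel-< {m} {n} m<n rewrite ℕtoℚ≡mkℚ m | ℕtoℚ≡mkℚ n with m<n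
... | ℚ.*<* m<n rewrite ℤ.*-identityʳ (+ m) | ℤ.*-identityʳ (+ n) = ℤ.drop‿+<+ m<n

ℕtoℚ-suc : ∀ n → ℕtoℚ (suc n) ≡ ℕtoℚ n ℚ.+ 1ℚ
ℕtoℚ-suc n = trans (cong ℕtoℚ (+-comm 1 n)) (ℕtoℚ-+ n 1)

ℕtoℚ-*-divℕ : ∀ T N .{{_ : NonZero N}} → ℕtoℚ N ℚ.* divℕ (+ T) N ≡ ℕtoℚ T
ℕtoℚ-*-divℕ T (suc K) = ℚ.toℚᵘ-injective
  (ℚᵘ.≃-trans (ℚ.toℚᵘ-homo-* (ℕtoℚ (suc K)) (divℕ (+ T) (suc K)))
  (ℚᵘ.≃-trans (ℚᵘ.*-cong (ℚ.toℚᵘ-fromℚᵘ (mkℚᵘ (+ suc K) 0)) (ℚ.toℚᵘ-fromℚᵘ (mkℚᵘ (+ T) K)))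
  (ℚᵘ.≃-trans (*≡* cross) (ℚᵘ.≃-sym (ℚ.toℚᵘ-fromℚᵘ (mkℚᵘ (+ T) 0))))))
  where
  cross : (+ suc K ℤ.* + T) ℤ.* + 1 ≡ + T ℤ.* + suc (K + 0)
  cross = trans (ℤ.*-identityʳ (+ suc K ℤ.* + T)) (trans (ℤ.*-comm (+ suc K) (+ T)) (cong (λ k → + T ℤ.* + suc k) (sym (+-identityʳ K))))

ℕtoℚ-*-cancelˡ : ∀ N .{{_ : NonZero N}} {p q} → ℕtoℚ N ℚ.* p ≡ ℕtoℚ N ℚ.* q → p ≡ q
ℕtoℚ-*-cancelˡ (suc K) eq rewrite ℕtoℚ≡mkℚ (suc K) =
  ℚ.≤-antisym (ℚ.*-cancelˡ-≤-pos _ (ℚ.≤-reflexive eq)) (ℚ.*-cancelˡ-≤-pos _ (ℚ.≤-reflexive (sym eq)))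

divℕ-unique : ∀ T N .{{_ : NonZero N}} {q} → ℕtoℚ N ℚ.* q ≡ ℕtoℚ T → q ≡ divℕ (+ T) N
divℕ-unique T N eq = ℕtoℚ-*-cancelˡ N (trans eq (sym (ℕtoℚ-*-divℕ T N)))

private
  ceiling-mkℚ : ∀ n d .(c : Coprime.Coprime n (suc d)) →
    (n % suc d ≡ 0 × ceiling (mkℚ (+ n) d c) ≡ + (n / suc d)) ⊎ ceiling (mkℚ (+ n) d c) ≡ + suc (n / suc d)
  ceiling-mkℚ zero    d c = inj₁ (refl , cong ℤ.-_ (ℤ.div-pos-is-/ℕ (+ 0) (suc d)))
  ceiling-mkℚ (suc k) d c = subst (λ x → (suc k % suc d ≡ 0 × x ≡ + (suc k / suc d)) ⊎ x ≡ + suc (suc k / suc d))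
                                  (sym (cong ℤ.-_ (ℤ.div-pos-is-/ℕ -[1+ k ] (suc d)))) by-remainder
    where
    by-remainder : (suc k % suc d ≡ 0 × ℤ.- (-[1+ k ] ℤ./ℕ suc d) ≡ + (suc k / suc d))
                   ⊎ ℤ.- (-[1+ k ] ℤ./ℕ suc d) ≡ + suc (suc k / suc d)
    by-remainder with suc k % suc d
    ... | zero  = inj₁ (refl , ℤ.neg-involutive _)
    ... | suc _ = inj₂ refl

  module InLowestTerms (T K n d : ℕ) .(c : Coprime.Coprime n (suc d)) (cross : n * suc K ≡ T * suc d) where

    quotient : n / suc d ≡ T / suc K
    quotient = begin
      n / suc d                     ≡⟨ m*n/m*o≡n/o (suc K) n (suc d) ⟨
      (suc K * n) / (suc K * suc d) ≡⟨ /-congˡ (trans (*-comm (suc K) n) cross) ⟩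
      (T * suc d) / (suc K * suc d) ≡⟨ /-congʳ {m = T * suc d} (*-comm (suc K) (suc d)) ⟩
      (T * suc d) / (suc d * suc K) ≡⟨ cong (_/ (suc d * suc K)) (*-comm T (suc d)) ⟩
      (suc d * T) / (suc d * suc K) ≡⟨ m*n/m*o≡n/o (suc d) T (suc K) ⟩
      T / suc K                     ∎

    integral : n % suc d ≡ 0 → mkℚ (+ n) d c ≡ ℕtoℚ (n / suc d)
    integral n%d≡0 = begin
      mkℚ (+ n) d c
        ≡⟨ ℚ.↥p/↧p≡p (mkℚ (+ n) d c) ⟨
      + n ℚ./ suc d
        ≡⟨ /-cross (+ n) (+ (n / suc d)) d 0 (trans (ℤ.*-identityʳ (+ n)) (trans (cong +_ n≡q*d) (ℤ.pos-* (n / suc d) (suc d)))) ⟩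
      + (n / suc d) ℚ./ 1 ∎
      where
      n≡q*d : n ≡ n / suc d * suc d
      n≡q*d = trans (m≡m%n+[m/n]*n n (suc d)) (cong (_+ n / suc d * suc d) n%d≡0)

  FloorCeiling : ℕ → ℚ → Set
  FloorCeiling a p = floor p ≡ + a × ((p ≡ ℕtoℚ a × ceiling p ≡ + a) ⊎ ceiling p ≡ + suc a)

  floor-ceiling : ∀ T K (p : ℚ) → .{{ℚ.NonNegative p}} →
                  toℚᵘ p ℚᵘ.≃ mkℚᵘ (+ T) K → FloorCeiling (T / suc K) p
  floor-ceiling T K (mkℚ (+ n) d c) cross =
    subst (λ a → FloorCeiling a (mkℚ (+ n) d c)) quotient (ℤ.div-pos-is-/ℕ (+ n) (suc d) , ceiling-cases (ceiling-mkℚ n d c))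
    where
    open InLowestTerms T K n d c (ℤ.+-injective (trans (ℤ.pos-* n (suc K)) (trans (ℚᵘ.drop-*≡* cross) (sym (ℤ.pos-* T (suc d))))))
    ceiling-cases : (n % suc d ≡ 0 × ceiling (mkℚ (+ n) d c) ≡ + (n / suc d)) ⊎ ceiling (mkℚ (+ n) d c) ≡ + suc (n / suc d) →
                    (mkℚ (+ n) d c ≡ ℕtoℚ (n / suc d) × ceiling (mkℚ (+ n) d c) ≡ + (n / suc d))
                    ⊎ ceiling (mkℚ (+ n) d c) ≡ + suc (n / suc d)
    ceiling-cases (inj₁ (n%d≡0 , ⌈p⌉≡a)) = inj₁ (integral n%d≡0 , ⌈p⌉≡a)
    ceiling-cases (inj₂ ⌈p⌉≡a+1)        = inj₂ ⌈p⌉≡a+1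

  floor-ceiling-divℕ : ∀ T N .{{_ : NonZero N}} → FloorCeiling (T / N) (divℕ (+ T) N)
  floor-ceiling-divℕ T (suc K) = floor-ceiling T K (divℕ (+ T) (suc K)) {{ℚ.normalize-nonNeg T (suc K)}}
                                   (ℚ.toℚᵘ-fromℚᵘ (mkℚᵘ (+ T) K))

floor-divℕ : ∀ T N .{{_ : NonZero N}} → floor (divℕ (+ T) N) ≡ + (T / N)
floor-divℕ T N = proj₁ (floor-ceiling-divℕ T N)

ceiling-divℕ : ∀ T N .{{_ : NonZero N}} →
               (divℕ (+ T) N ≡ ℕtoℚ (T / N) × ceiling (divℕ (+ T) N) ≡ + (T / N))
               ⊎ ceiling (divℕ (+ T) N) ≡ + suc (T / N)
ceiling-divℕ T N = proj₂ (floor-ceiling-divℕ T N)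

-- Convexity of n ↦ n C 2

-- The sum of x C 2 over the family with T % N members equal to T / N + 1 and the others to T / N.
minΣC2 : (N T : ℕ) .{{_ : NonZero N}} → ℕ
minΣC2 N T = N * (T / N C 2) + T % N * (T / N)

private
  -- k (k + 1) = (x − a) (x − a − 1)
  square-gap : ∀ a x → ∃[ k ] x * x + a * suc a ≡ (a + a + 1) * x + k * suc k × (k ≡ 0 → x ≡ a ⊎ x ≡ suc a)
  square-gap a x with x ≤? a
  ... | yes x≤a with m≤n⇒∃[o]m+o≡n x≤a
  ...   | k , refl = k , below x k , λ { refl → inj₁ (sym (+-identityʳ x)) }
    where
    below : ∀ x k → x * x + (x + k) * suc (x + k) ≡ ((x + k) + (x + k) + 1) * x + k * suc k
    below = solve-∀
  square-gap a x | no x≰a with m≤n⇒∃[o]m+o≡n (≰⇒> x≰a)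
  ...   | k , refl = k , above a k , λ { refl → inj₂ (+-identityʳ (suc a)) }
    where
    above : ∀ a k → (suc a + k) * (suc a + k) + a * suc a ≡ (a + a + 1) * (suc a + k) + k * suc k
    above = solve-∀

  C2-chord-gap : ∀ a x → ∃[ k ] 2 * (a C 2 + a * x) + k * suc k ≡ 2 * (x C 2 + a * a) × (k ≡ 0 → x ≡ a ⊎ x ≡ suc a)
  C2-chord-gap a x with square-gap a x
  ... | k , gap , k≡0⇒near = k , +-cancelʳ-≡ (x + a) _ _ doubled , k≡0⇒near
    where
    doubled : 2 * (a C 2 + a * x) + k * suc k + (x + a) ≡ 2 * (x C 2 + a * a) + (x + a)
    doubled = begin
      2 * (a C 2 + a * x) + k * suc k + (x + a)         ≡⟨ regroup (a C 2) a x (k * suc k) ⟩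
      (2 * (a C 2) + a) + ((a + a + 1) * x + k * suc k) ≡⟨ cong₂ _+_ (2*C2+n≡n*n a) (sym gap) ⟩
      a * a + (x * x + a * suc a)                       ≡⟨ cong (λ y → a * a + (y + a * suc a)) (sym (2*C2+n≡n*n x)) ⟩
      a * a + ((2 * (x C 2) + x) + a * suc a)           ≡⟨ regroup′ (x C 2) a x ⟩
      2 * (x C 2 + a * a) + (x + a)                     ∎
      where
      regroup : ∀ c a x g → 2 * (c + a * x) + g + (x + a) ≡ (2 * c + a) + ((a + a + 1) * x + g)
      regroup = solve-∀
      regroup′ : ∀ c a x → a * a + ((2 * c + x) + a * suc a) ≡ 2 * (c + a * a) + (x + a)
      regroup′ = solve-∀

C2-above-chord : ∀ a x → a C 2 + a * x ≤ x C 2 + a * a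
C2-above-chord a x with C2-chord-gap a x
... | k , gap , _ = *-cancelˡ-≤ 2 (≤-trans (m≤m+n _ (k * suc k)) (≤-reflexive gap))

C2-on-chord⇔ : ∀ a x → (a C 2 + a * x ≡ x C 2 + a * a) ⇔ (x ≡ a ⊎ x ≡ suc a)
C2-on-chord⇔ a x = mk⇔ on-chord⇒node node⇒on-chord
  where
  on-chord⇒node : a C 2 + a * x ≡ x C 2 + a * a → x ≡ a ⊎ x ≡ suc a
  on-chord⇒node eq with C2-chord-gap a x
  ... | k , gap , k≡0⇒near with m*n≡0⇒m≡0∨n≡0 k (+-cancelˡ-≡ (2 * (a C 2 + a * x)) _ 0
                                 (trans gap (trans (cong (2 *_) (sym eq)) (sym (+-identityʳ _)))))
  ...   | inj₁ k≡0 = k≡0⇒near k≡0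
  node⇒on-chord : x ≡ a ⊎ x ≡ suc a → a C 2 + a * x ≡ x C 2 + a * a
  node⇒on-chord (inj₁ refl) = refl
  node⇒on-chord (inj₂ refl) = trans (right-node (a C 2) a) (cong (_+ a * a) (sym (suc-C2 a)))
    where
    right-node : ∀ c a → c + a * suc a ≡ (a + c) + a * a
    right-node = solve-∀

module _ {m n : ℕ} (sel : Selection m n) (x : Fin m → Fin n → ℕ)
         {N : ℕ} .{{_ : NonZero N}} (count : ∑⟨ sel ⟩ (λ _ _ → 1) ≡ N) where

  private
    Σx = ∑⟨ sel ⟩ x
    q⁻ = Σx / N

    ∑⟨⟩-const : ∀ c → ∑⟨ sel ⟩ (λ _ _ → c) ≡ N * c
    ∑⟨⟩-const c = begin
      ∑⟨ sel ⟩ (λ _ _ → c)     ≡⟨ ∑⟨⟩-cong sel (λ _ _ _ → sym (*-identityʳ c)) ⟩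
      ∑⟨ sel ⟩ (λ _ _ → c * 1) ≡⟨ ∑⟨⟩-*ˡ sel c (λ _ _ → 1) ⟩
      c * ∑⟨ sel ⟩ (λ _ _ → 1) ≡⟨ cong (c *_) count ⟩
      c * N                    ≡⟨ *-comm c N ⟩
      N * c                    ∎

    chord-sum : ∑⟨ sel ⟩ (λ i j → q⁻ C 2 + q⁻ * x i j) ≡ minΣC2 N Σx + N * (q⁻ * q⁻)
    chord-sum = begin
      ∑⟨ sel ⟩ (λ i j → q⁻ C 2 + q⁻ * x i j)     ≡⟨ ∑⟨⟩-+ sel (λ _ _ → q⁻ C 2) (λ i j → q⁻ * x i j) ⟩
      ∑⟨ sel ⟩ (λ _ _ → q⁻ C 2) + ∑⟨ sel ⟩ (λ i j → q⁻ * x i j)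
                                              ≡⟨ cong₂ _+_ (∑⟨⟩-const (q⁻ C 2)) (∑⟨⟩-*ˡ sel q⁻ x) ⟩
      N * (q⁻ C 2) + q⁻ * Σx                ≡⟨ cong (λ t → N * (q⁻ C 2) + q⁻ * t) (m≡m%n+[m/n]*n Σx N) ⟩
      N * (q⁻ C 2) + q⁻ * (Σx % N + q⁻ * N) ≡⟨ regroup N (q⁻ C 2) q⁻ (Σx % N) ⟩
      minΣC2 N Σx + N * (q⁻ * q⁻)           ∎
      where
      regroup : ∀ N c q⁻ b → N * c + q⁻ * (b + q⁻ * N) ≡ N * c + b * q⁻ + N * (q⁻ * q⁻)
      regroup = solve-∀

    above-sum : ∑⟨ sel ⟩ (λ i j → x i j C 2 + q⁻ * q⁻) ≡ ∑⟨ sel ⟩ (λ i j → x i j C 2) + N * (q⁻ * q⁻)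
    above-sum = trans (∑⟨⟩-+ sel (λ i j → x i j C 2) (λ _ _ → q⁻ * q⁻))
                      (cong (λ y → ∑⟨ sel ⟩ (λ i j → x i j C 2) + y) (∑⟨⟩-const (q⁻ * q⁻)))

    chord≤C2 : AllOn sel (λ i j → q⁻ C 2 + q⁻ * x i j ≤ x i j C 2 + q⁻ * q⁻)
    chord≤C2 i j _ = C2-above-chord q⁻ (x i j)

  minΣC2-≤ : minΣC2 N Σx ≤ ∑⟨ sel ⟩ (λ i j → x i j C 2)
  minΣC2-≤ = +-cancelʳ-≤ (N * (q⁻ * q⁻)) _ _
    (subst₂ _≤_ chord-sum above-sum (∑⟨⟩-mono-≤ sel chord≤C2))

  minΣC2-≡⇔ : minΣC2 N Σx ≡ ∑⟨ sel ⟩ (λ i j → x i j C 2) ⇔ AllOn sel (λ i j → x i j ≡ q⁻ ⊎ x i j ≡ suc q⁻)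
  minΣC2-≡⇔ = mk⇔ tight⇒nodes nodes⇒tight
    where
    tight⇒nodes : minΣC2 N Σx ≡ ∑⟨ sel ⟩ (λ i j → x i j C 2) → AllOn sel (λ i j → x i j ≡ q⁻ ⊎ x i j ≡ suc q⁻)
    tight⇒nodes eq i j s = Equivalence.to (C2-on-chord⇔ q⁻ (x i j))
      (∑⟨⟩-mono-≤-≡⇒≡ sel chord≤C2 (trans chord-sum (trans (cong (_+ N * (q⁻ * q⁻)) eq) (sym above-sum))) i j s)
    nodes⇒tight : AllOn sel (λ i j → x i j ≡ q⁻ ⊎ x i j ≡ suc q⁻) → minΣC2 N Σx ≡ ∑⟨ sel ⟩ (λ i j → x i j C 2)
    nodes⇒tight nodes = +-cancelʳ-≡ (N * (q⁻ * q⁻)) _ _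
      (trans (sym chord-sum) (trans (∑⟨⟩-cong sel (λ i j s → Equivalence.from (C2-on-chord⇔ q⁻ (x i j)) (nodes i j s))) above-sum))

  nodes-at-integral-mean : Σx ≡ N * q⁻ → AllOn sel (λ i j → x i j ≡ q⁻ ⊎ x i j ≡ suc q⁻) → AllOn sel (λ i j → x i j ≡ q⁻)
  nodes-at-integral-mean Σx≡Nq⁻ nodes i j s =
    sym (∑⟨⟩-mono-≤-≡⇒≡ sel q⁻≤x (trans (∑⟨⟩-const q⁻) (sym Σx≡Nq⁻)) i j s)
    where
    q⁻≤x : AllOn sel (λ i j → q⁻ ≤ x i j)
    q⁻≤x i j s with nodes i j s
    ... | inj₁ x≡q⁻  = ≤-reflexive (sym x≡q⁻)
    ... | inj₂ x≡1+q⁻ = ≤-trans (n≤1+n q⁻) (≤-reflexive (sym x≡1+q⁻))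

-- S(N, T/N) as a least sum of binomial coefficients

ℕtoℚ-C2 : ∀ n → ℕtoℚ (n C 2) ≡ ℕtoℚ n ℚ.* (ℕtoℚ n ℚ.- 1ℚ) ℚ.* ½
ℕtoℚ-C2 n = begin
  c                                 ≡⟨ halve c (ι n) ⟩
  ((c ℚ.+ c ℚ.+ ι n) ℚ.- ι n) ℚ.* ½ ≡⟨ cong (λ y → (y ℚ.- ι n) ℚ.* ½) doubled ⟩
  (ι n ℚ.* ι n ℚ.- ι n) ℚ.* ½       ≡⟨ factor (ι n) ⟩
  ι n ℚ.* (ι n ℚ.- 1ℚ) ℚ.* ½        ∎
  where
  open +-*-Solver
  ι = ℕtoℚ
  c = ι (n C 2)
  doubled : c ℚ.+ c ℚ.+ ι n ≡ ι n ℚ.* ι n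
  doubled = begin
    c ℚ.+ c ℚ.+ ι n           ≡⟨ cong (ℚ._+ ι n) (sym (ℕtoℚ-+ (n C 2) (n C 2))) ⟩
    ι (n C 2 + n C 2) ℚ.+ ι n ≡⟨ sym (ℕtoℚ-+ (n C 2 + n C 2) n) ⟩
    ι (n C 2 + n C 2 + n)     ≡⟨ cong (λ y → ι (n C 2 + y + n)) (sym (+-identityʳ (n C 2))) ⟩
    ι (2 * (n C 2) + n)       ≡⟨ cong ι (2*C2+n≡n*n n) ⟩
    ι (n * n)                 ≡⟨ ℕtoℚ-* n n ⟩
    ι n ℚ.* ι n               ∎
  halve : ∀ c n → c ≡ ((c ℚ.+ c ℚ.+ n) ℚ.- n) ℚ.* ½
  halve = solve 2 (λ c n → c := ((c :+ c :+ n) :- n) :* con ½) refl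
  factor : ∀ n → (n ℚ.* n ℚ.- n) ℚ.* ½ ≡ n ℚ.* (n ℚ.- 1ℚ) ℚ.* ½
  factor = solve 1 (λ n → (n :* n :- n) :* con ½ := n :* (n :- con 1ℚ) :* con ½) refl

S≡N*chord : ∀ N q a → lo q ≡ ℕtoℚ a → (q ≡ ℕtoℚ a × hi q ≡ ℕtoℚ a) ⊎ hi q ≡ ℕtoℚ a ℚ.+ 1ℚ →
            S N q ≡ ℕtoℚ N ℚ.* (ℕtoℚ (a C 2) ℚ.+ ℕtoℚ a ℚ.* (q ℚ.- ℕtoℚ a))
S≡N*chord N q a lo≡α hi≡ = begin
  S N q                                    ≡⟨ on-chord hi≡ ⟩
  ν ℚ.* (c₂ ℚ.+ α ℚ.* (q ℚ.- α))           ≡⟨ cong (λ c → ν ℚ.* (c ℚ.+ α ℚ.* (q ℚ.- α))) (ℕtoℚ-C2 a) ⟨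
  ν ℚ.* (ℕtoℚ (a C 2) ℚ.+ α ℚ.* (q ℚ.- α)) ∎
  where
  open +-*-Solver
  ν = ℕtoℚ N
  α = ℕtoℚ a
  c₂ = α ℚ.* (α ℚ.- 1ℚ) ℚ.* ½
  S′ : ℚ → ℚ → ℚ
  S′ q h = ν ℚ.* binom2 q ℚ.+ ν ℚ.* (q ℚ.- α) ℚ.* (h ℚ.- q) ℚ.* ½
  on-chord : (q ≡ α × hi q ≡ α) ⊎ hi q ≡ α ℚ.+ 1ℚ → S N q ≡ ν ℚ.* (c₂ ℚ.+ α ℚ.* (q ℚ.- α))
  on-chord (inj₂ hi≡α+1) = begin
    S N q                          ≡⟨ cong₂ (λ l h → ν ℚ.* binom2 q ℚ.+ ν ℚ.* (q ℚ.- l) ℚ.* (h ℚ.- q) ℚ.* ½) lo≡α hi≡α+1 ⟩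
    S′ q (α ℚ.+ 1ℚ)                ≡⟨ between-nodes ν q α ⟩
    ν ℚ.* (c₂ ℚ.+ α ℚ.* (q ℚ.- α)) ∎
    where
    between-nodes : ∀ ν q α → ν ℚ.* (q ℚ.* (q ℚ.- 1ℚ) ℚ.* ½) ℚ.+ ν ℚ.* (q ℚ.- α) ℚ.* ((α ℚ.+ 1ℚ) ℚ.- q) ℚ.* ½
                              ≡ ν ℚ.* (α ℚ.* (α ℚ.- 1ℚ) ℚ.* ½ ℚ.+ α ℚ.* (q ℚ.- α))
    between-nodes = solve 3 (λ ν q α →
      ν :* (q :* (q :- con 1ℚ) :* con ½) :+ ν :* (q :- α) :* ((α :+ con 1ℚ) :- q) :* con ½
      := ν :* (α :* (α :- con 1ℚ) :* con ½ :+ α :* (q :- α))) refl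
  on-chord (inj₁ (q≡α , hi≡α)) = begin
    S N q                          ≡⟨ cong₂ (λ l h → ν ℚ.* binom2 q ℚ.+ ν ℚ.* (q ℚ.- l) ℚ.* (h ℚ.- q) ℚ.* ½) lo≡α hi≡α ⟩
    S′ q α                         ≡⟨ cong (λ y → S′ y α) q≡α ⟩
    S′ α α                         ≡⟨ at-node ν α ⟩
    ν ℚ.* (c₂ ℚ.+ α ℚ.* (α ℚ.- α)) ≡⟨ cong (λ y → ν ℚ.* (c₂ ℚ.+ α ℚ.* (y ℚ.- α))) q≡α ⟨
    ν ℚ.* (c₂ ℚ.+ α ℚ.* (q ℚ.- α)) ∎
    where
    at-node : ∀ ν α → ν ℚ.* (α ℚ.* (α ℚ.- 1ℚ) ℚ.* ½) ℚ.+ ν ℚ.* (α ℚ.- α) ℚ.* (α ℚ.- α) ℚ.* ½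
                      ≡ ν ℚ.* (α ℚ.* (α ℚ.- 1ℚ) ℚ.* ½ ℚ.+ α ℚ.* (α ℚ.- α))
    at-node = solve 2 (λ ν α →
      ν :* (α :* (α :- con 1ℚ) :* con ½) :+ ν :* (α :- α) :* (α :- α) :* con ½
      := ν :* (α :* (α :- con 1ℚ) :* con ½ :+ α :* (α :- α))) refl

S-divℕ : ∀ N T .{{_ : NonZero N}} → S N (divℕ (+ T) N) ≡ ℕtoℚ (minΣC2 N T)
S-divℕ N T = begin
  S N q                                            ≡⟨ S≡N*chord N q q⁻ (cong (ℚ._/ 1) (floor-divℕ T N)) hi-cases ⟩
  ν ℚ.* (c₂ ℚ.+ α ℚ.* (q ℚ.- α))                   ≡⟨ distribute ν c₂ α q ⟩
  ν ℚ.* c₂ ℚ.+ α ℚ.* (ν ℚ.* q ℚ.- α ℚ.* ν)         ≡⟨ cong (λ t → ν ℚ.* c₂ ℚ.+ α ℚ.* (t ℚ.- α ℚ.* ν)) νq≡β+αν ⟩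
  ν ℚ.* c₂ ℚ.+ α ℚ.* ((β ℚ.+ α ℚ.* ν) ℚ.- α ℚ.* ν) ≡⟨ cancel (ν ℚ.* c₂) α β ν ⟩
  ν ℚ.* c₂ ℚ.+ β ℚ.* α                             ≡⟨ cong₂ ℚ._+_ (ℕtoℚ-* N (q⁻ C 2)) (ℕtoℚ-* rem q⁻) ⟨
  ℕtoℚ (N * (q⁻ C 2)) ℚ.+ ℕtoℚ (rem * q⁻)          ≡⟨ ℕtoℚ-+ (N * (q⁻ C 2)) (rem * q⁻) ⟨
  ℕtoℚ (minΣC2 N T)                                ∎
  where
  open +-*-Solver
  q = divℕ (+ T) N
  q⁻ = T / N
  rem = T % N
  ν = ℕtoℚ N
  α = ℕtoℚ q⁻
  β = ℕtoℚ rem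
  c₂ = ℕtoℚ (q⁻ C 2)

  hi-cases : (q ≡ α × hi q ≡ α) ⊎ hi q ≡ α ℚ.+ 1ℚ
  hi-cases with ceiling-divℕ T N
  ... | inj₁ (q≡α , ⌈q⌉≡q⁻) = inj₁ (q≡α , cong (ℚ._/ 1) ⌈q⌉≡q⁻)
  ... | inj₂ ⌈q⌉≡q⁻+1       = inj₂ (trans (cong (ℚ._/ 1) ⌈q⌉≡q⁻+1) (ℕtoℚ-suc q⁻))

  νq≡β+αν : ν ℚ.* q ≡ β ℚ.+ α ℚ.* ν
  νq≡β+αν = begin
    ν ℚ.* q             ≡⟨ ℕtoℚ-*-divℕ T N ⟩
    ℕtoℚ T              ≡⟨ cong ℕtoℚ (m≡m%n+[m/n]*n T N) ⟩
    ℕtoℚ (rem + q⁻ * N) ≡⟨ trans (ℕtoℚ-+ rem (q⁻ * N)) (cong (β ℚ.+_) (ℕtoℚ-* q⁻ N)) ⟩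
    β ℚ.+ α ℚ.* ν       ∎

  distribute : ∀ ν c α q → ν ℚ.* (c ℚ.+ α ℚ.* (q ℚ.- α)) ≡ ν ℚ.* c ℚ.+ α ℚ.* (ν ℚ.* q ℚ.- α ℚ.* ν)
  distribute = solve 4 (λ ν c α q → ν :* (c :+ α :* (q :- α)) := ν :* c :+ α :* (ν :* q :- α :* ν)) refl
  cancel : ∀ x α β ν → x ℚ.+ α ℚ.* ((β ℚ.+ α ℚ.* ν) ℚ.- α ℚ.* ν) ≡ x ℚ.+ β ℚ.* α
  cancel = solve 4 (λ x α β ν → x :+ α :* ((β :+ α :* ν) :- α :* ν) := x :+ β :* α) refl

-- Defs.InFloorCeil without its design argument.
FloorOrCeiling : ℕ → ℚ → Set
FloorOrCeiling k q = (+ k ≡ floor q) ⊎ (+ k ≡ ceiling q)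

module _ {m n : ℕ} (sel : Selection m n) (x : Fin m → Fin n → ℕ)
         {N : ℕ} .{{_ : NonZero N}} (count : ∑⟨ sel ⟩ (λ _ _ → 1) ≡ N) where

  private
    Σx = ∑⟨ sel ⟩ x
    q = divℕ (+ Σx) N
    q⁻ = Σx / N

    FloorOrCeiling⇒node : ∀ {k} → FloorOrCeiling k q → k ≡ q⁻ ⊎ k ≡ suc q⁻
    FloorOrCeiling⇒node (inj₁ k≡⌊q⌋) = inj₁ (ℤ.+-injective (trans k≡⌊q⌋ (floor-divℕ Σx N)))
    FloorOrCeiling⇒node (inj₂ k≡⌈q⌉) with ceiling-divℕ Σx N
    ... | inj₁ (_ , ⌈q⌉≡q⁻) = inj₁ (ℤ.+-injective (trans k≡⌈q⌉ ⌈q⌉≡q⁻))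
    ... | inj₂ ⌈q⌉≡q⁻+1     = inj₂ (ℤ.+-injective (trans k≡⌈q⌉ ⌈q⌉≡q⁻+1))

    nodes⇒FloorOrCeiling : AllOn sel (λ i j → x i j ≡ q⁻ ⊎ x i j ≡ suc q⁻) → AllOn sel (λ i j → FloorOrCeiling (x i j) q)
    nodes⇒FloorOrCeiling nodes i j s with ceiling-divℕ Σx N | nodes i j s
    ... | inj₁ (q≡q⁻ , _) | _ =
      inj₁ (trans (cong +_ (nodes-at-integral-mean sel x count Σx≡Nq⁻ nodes i j s)) (sym (floor-divℕ Σx N)))
      where
      Σx≡Nq⁻ : Σx ≡ N * q⁻
      Σx≡Nq⁻ = ℕtoℚ-injective (trans (sym (ℕtoℚ-*-divℕ Σx N)) (trans (cong (ℕtoℚ N ℚ.*_) q≡q⁻) (sym (ℕtoℚ-* N q⁻))))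
    ... | inj₂ _         | inj₁ x≡q⁻    = inj₁ (trans (cong +_ x≡q⁻) (sym (floor-divℕ Σx N)))
    ... | inj₂ ⌈q⌉≡q⁻+1   | inj₂ x≡1+q⁻  = inj₂ (trans (cong +_ x≡1+q⁻) (sym ⌈q⌉≡q⁻+1))

  minΣC2-≡⇔FloorOrCeiling : minΣC2 N Σx ≡ ∑⟨ sel ⟩ (λ i j → x i j C 2) ⇔ AllOn sel (λ i j → FloorOrCeiling (x i j) q)
  minΣC2-≡⇔FloorOrCeiling =
    mk⇔ nodes⇒FloorOrCeiling (λ h i j s → FloorOrCeiling⇒node (h i j s)) ⇔-∘ minΣC2-≡⇔ sel x count

ℕtoℚ-C2-*-divℕ-pred : ∀ k .{{_ : NonZero (k ∸ 1)}} X →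
                      ℕtoℚ (k C 2) ℚ.* (X ℚ.* divℕ (+ 1) (k ∸ 1)) ≡ ℕtoℚ k ℚ.* X ℚ.* ½
ℕtoℚ-C2-*-divℕ-pred (suc m) X = begin
  ℕtoℚ (suc m C 2) ℚ.* (X ℚ.* w)                ≡⟨ cong (ℚ._* (X ℚ.* w)) (ℕtoℚ-C2 (suc m)) ⟩
  κ ℚ.* (κ ℚ.- 1ℚ) ℚ.* ½ ℚ.* (X ℚ.* w)          ≡⟨ cong (λ y → κ ℚ.* (y ℚ.- 1ℚ) ℚ.* ½ ℚ.* (X ℚ.* w)) (ℕtoℚ-suc m) ⟩
  κ ℚ.* ((μ ℚ.+ 1ℚ) ℚ.- 1ℚ) ℚ.* ½ ℚ.* (X ℚ.* w) ≡⟨ regroup κ μ X w ⟩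
  κ ℚ.* X ℚ.* ½ ℚ.* (μ ℚ.* w)                   ≡⟨ cong (κ ℚ.* X ℚ.* ½ ℚ.*_) (ℕtoℚ-*-divℕ 1 m) ⟩
  κ ℚ.* X ℚ.* ½ ℚ.* 1ℚ                          ≡⟨ ℚ.*-identityʳ (κ ℚ.* X ℚ.* ½) ⟩
  κ ℚ.* X ℚ.* ½                                 ∎
  where
  open +-*-Solver
  κ = ℕtoℚ (suc m)
  μ = ℕtoℚ m
  w = divℕ (+ 1) m
  regroup : ∀ κ μ X w → κ ℚ.* ((μ ℚ.+ 1ℚ) ℚ.- 1ℚ) ℚ.* ½ ℚ.* (X ℚ.* w) ≡ κ ℚ.* X ℚ.* ½ ℚ.* (μ ℚ.* w)
  regroup = solve 4 (λ κ μ X w → κ :* ((μ :+ con 1ℚ) :- con 1ℚ) :* con ½ :* (X :* w) := κ :* X :* con ½ :* (μ :* w)) refl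

countF-all-false : (p : Fin n → Bool) → (∀ j → p j ≡ false) → countF p ≡ 0
countF-all-false {zero}  p all-false = refl
countF-all-false {suc n} p all-false rewrite all-false zero = countF-all-false (p ∘ suc) (all-false ∘ suc)

countF-≤1 : (p : Fin n → Bool) → (∀ j j' → T (p j) → T (p j') → j ≡ j') → countF p ≡ ⟦ anyF p ⟧
countF-≤1 {zero}  p unique = refl
countF-≤1 {suc n} p unique with p zero in p₀
... | true  = cong suc (countF-all-false (p ∘ suc) rest-false)
  where
  rest-false : ∀ j → p (suc j) ≡ false
  rest-false j with p (suc j) in pⱼ
  ... | true  = contradiction (unique zero (suc j) (subst T (sym p₀) _) (subst T (sym pⱼ) _)) (λ ())
  ... | false = refl
... | false = countF-≤1 (p ∘ suc) (λ j j' pj pj' → Fin.suc-injective (unique (suc j) (suc j') pj pj'))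

T-does⇒ : {A : Set} (a? : Dec A) → T (does a?) → A
T-does⇒ (yes a) _ = a

anyF-intro : (p : Fin n → Bool) (j : Fin n) → T (p j) → T (anyF p)
anyF-intro p zero    pj with p zero
... | true = _
anyF-intro p (suc j) pj with p zero
... | true  = _
... | false = anyF-intro (p ∘ suc) j pj

⟦⟧-T : ∀ {b} → T b → ⟦ b ⟧ ≡ 1
⟦⟧-T {true} _ = refl

countF-≟-singleton : ∀ {v} (y : Fin v) → countF (λ s → does (y Fin.≟ s)) ≡ 1
countF-≟-singleton y = begin
  countF (λ s → does (y Fin.≟ s))
    ≡⟨ countF-≤1 (λ s → does (y Fin.≟ s))
                 (λ s s' y≡s y≡s' → trans (sym (T-does⇒ (y Fin.≟ s) y≡s)) (T-does⇒ (y Fin.≟ s') y≡s')) ⟩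
  ⟦ anyF (λ s → does (y Fin.≟ s)) ⟧
    ≡⟨ ⟦⟧-T (anyF-intro (λ s → does (y Fin.≟ s)) y (subst T (sym (dec-true (y Fin.≟ y) refl)) _)) ⟩
  1 ∎

module _ {m v : ℕ} (g : Fin m → Fin v) (g-injective : ∀ j j' → g j ≡ g j' → j ≡ j') where

  preimage-size : ∀ s → countF (λ j → does (g j Fin.≟ s)) ≡ ⟦ anyF (λ j → does (g j Fin.≟ s)) ⟧
  preimage-size s = countF-≤1 (λ j → does (g j Fin.≟ s))
    (λ j j' gj≡s gj'≡s → g-injective j j' (trans (T-does⇒ (g j Fin.≟ s) gj≡s) (sym (T-does⇒ (g j' Fin.≟ s) gj'≡s))))

  image-size : countF (λ s → anyF (λ j → does (g j Fin.≟ s))) ≡ m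
  image-size = begin
    countF (λ s → anyF (λ j → does (g j Fin.≟ s)))
      ≡⟨ countF≡∑ (λ s → anyF (λ j → does (g j Fin.≟ s))) ⟩
    ∑[ s < v ] ⟦ anyF (λ j → does (g j Fin.≟ s)) ⟧
      ≡⟨ sum-cong-≗ (λ s → trans (sym (preimage-size s)) (countF≡∑ (λ j → does (g j Fin.≟ s)))) ⟩
    ∑[ s < v ] ∑[ j < m ] ⟦ does (g j Fin.≟ s) ⟧
      ≡⟨ ∑-comm (λ s j → ⟦ does (g j Fin.≟ s) ⟧) ⟩
    ∑[ j < m ] ∑[ s < v ] ⟦ does (g j Fin.≟ s) ⟧
      ≡⟨ sum-cong-≗ (λ j → trans (sym (countF≡∑ (λ s → does (g j Fin.≟ s)))) (countF-≟-singleton (g j))) ⟩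
    ∑[ j < m ] 1
      ≡⟨ trans (∑-const m 1) (*-identityʳ m) ⟩
    m ∎

module BinaryDesign {r c v : ℕ} (d : Design r c v) (binary : Binary d) where

  row-size : ∀ i → countF (inRow d i) ≡ c
  row-size i = image-size (d i) (proj₁ binary i)

  col-size : ∀ j → countF (inCol d j) ≡ r
  col-size j = image-size (λ i → d i j) (proj₂ binary j)

  occ≡row-degree : ∀ s → occ d s ≡ countF (λ i → inRow d i s)
  occ≡row-degree s = begin
    occ d s                                        ≡⟨ sumF≡∑ (λ i → countF (λ j → does (d i j Fin.≟ s))) ⟩
    ∑[ i < r ] countF (λ j → does (d i j Fin.≟ s)) ≡⟨ sum-cong-≗ (λ i → preimage-size (d i) (proj₁ binary i) s) ⟩
    ∑[ i < r ] ⟦ inRow d i s ⟧                     ≡⟨ countF≡∑ (λ i → inRow d i s) ⟨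
    countF (λ i → inRow d i s)                     ∎

  occ≡col-degree : ∀ s → occ d s ≡ countF (λ j → inCol d j s)
  occ≡col-degree s = begin
    occ d s
      ≡⟨ sumF≡∑ (λ i → countF (λ j → does (d i j Fin.≟ s))) ⟩
    ∑[ i < r ] countF (λ j → does (d i j Fin.≟ s))
      ≡⟨ sum-cong-≗ (λ i → countF≡∑ (λ j → does (d i j Fin.≟ s))) ⟩
    ∑[ i < r ] ∑[ j < c ] ⟦ does (d i j Fin.≟ s) ⟧
      ≡⟨ ∑-comm (λ i j → ⟦ does (d i j Fin.≟ s) ⟧) ⟩
    ∑[ j < c ] ∑[ i < r ] ⟦ does (d i j Fin.≟ s) ⟧
      ≡⟨ sum-cong-≗ (λ j → trans (sym (countF≡∑ (λ i → does (d i j Fin.≟ s))))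
                                 (preimage-size (λ i → d i j) (proj₂ binary j) s)) ⟩
    ∑[ j < c ] ⟦ inCol d j s ⟧
      ≡⟨ countF≡∑ (λ j → inCol d j s) ⟨
    countF (λ j → inCol d j s) ∎

  ∑-occ : ∑[ s < v ] occ d s ≡ r * c
  ∑-occ = begin
    ∑[ s < v ] occ d s                    ≡⟨ sum-cong-≗ occ≡row-degree ⟩
    ∑[ s < v ] countF (λ i → inRow d i s) ≡⟨ ∑-countFᵀ (inRow d) ⟩
    ∑[ i < r ] countF (inRow d i)         ≡⟨ trans (sum-cong-≗ row-size) (∑-const r c) ⟩
    r * c                                 ∎

  Σocc² : ℕ
  Σocc² = ∑[ s < v ] (occ d s * occ d s)

  private
    ∑∑-meet-occ : ∀ {a b} (F : Fin a → Fin v → Bool) (G : Fin b → Fin v → Bool) →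
                  (∀ s → countF ((F ᵀ) s) ≡ occ d s) → (∀ s → countF ((G ᵀ) s) ≡ occ d s) →
                  ∑⟨ full ⟩ (meet F G) ≡ Σocc²
    ∑∑-meet-occ F G F-occ G-occ = trans (∑∑-meet F G) (sum-cong-≗ (λ s → cong₂ _*_ (F-occ s) (G-occ s)))

  ∑∑-rcI : ∑⟨ full ⟩ (rcI d) ≡ Σocc²
  ∑∑-rcI = ∑∑-meet-occ (inRow d) (inCol d) (sym ∘ occ≡row-degree) (sym ∘ occ≡col-degree)

  Σocc²≡rc+2∑rrI : Σocc² ≡ r * c + 2 * ∑⟨ ascending ⟩ (rrI d)
  Σocc²≡rc+2∑rrI = begin
    Σocc²
      ≡⟨ ∑∑-meet-occ (inRow d) (inRow d) (sym ∘ occ≡row-degree) (sym ∘ occ≡row-degree) ⟨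
    ∑⟨ full ⟩ (rrI d)
      ≡⟨ ∑∑-symmetric (rrI d) (meet-comm (inRow d) (inRow d)) ⟩
    ∑[ i < r ] rrI d i i + 2 * ∑⟨ ascending ⟩ (rrI d)
      ≡⟨ cong (_+ 2 * ∑⟨ ascending ⟩ (rrI d)) (trans (sum-cong-≗ (λ i → trans (meet-diag (inRow d) i) (row-size i))) (∑-const r c)) ⟩
    r * c + 2 * ∑⟨ ascending ⟩ (rrI d) ∎

  Σocc²≡cr+2∑ccI : Σocc² ≡ c * r + 2 * ∑⟨ ascending ⟩ (ccI d)
  Σocc²≡cr+2∑ccI = begin
    Σocc²
      ≡⟨ ∑∑-meet-occ (inCol d) (inCol d) (sym ∘ occ≡col-degree) (sym ∘ occ≡col-degree) ⟨
    ∑⟨ full ⟩ (ccI d)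
      ≡⟨ ∑∑-symmetric (ccI d) (meet-comm (inCol d) (inCol d)) ⟩
    ∑[ j < c ] ccI d j j + 2 * ∑⟨ ascending ⟩ (ccI d)
      ≡⟨ cong (_+ 2 * ∑⟨ ascending ⟩ (ccI d)) (trans (sum-cong-≗ (λ j → trans (meet-diag (inCol d) j) (col-size j))) (∑-const c r)) ⟩
    c * r + 2 * ∑⟨ ascending ⟩ (ccI d) ∎

  rcc+crr≡2rc+2∑co : r * (c * c) + c * (r * r) ≡ 2 * (r * c) + 2 * ∑⟨ ascending ⟩ (co-occurrence (inRow d) (inCol d))
  rcc+crr≡2rc+2∑co = begin
    r * (c * c) + c * (r * r)
      ≡⟨ cong₂ _+_ (trans (sum-cong-≗ (λ i → cong₂ _*_ (row-size i) (row-size i))) (∑-const r (c * c)))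
                   (trans (sum-cong-≗ (λ j → cong₂ _*_ (col-size j) (col-size j))) (∑-const c (r * r))) ⟨
    ∑[ i < r ] (countF (inRow d i) * countF (inRow d i)) + ∑[ j < c ] (countF (inCol d j) * countF (inCol d j))
      ≡⟨ ∑∑-co-occurrence (inRow d) (inCol d) ⟨
    ∑⟨ full ⟩ co
      ≡⟨ ∑∑-symmetric co (co-occurrence-sym (inRow d) (inCol d)) ⟩
    ∑[ s < v ] co s s + 2 * ∑⟨ ascending ⟩ co
      ≡⟨ cong (_+ 2 * ∑⟨ ascending ⟩ co) ∑-co-diag ⟩
    2 * (r * c) + 2 * ∑⟨ ascending ⟩ co ∎
    where
    co = co-occurrence (inRow d) (inCol d)
    ∑-co-diag : ∑[ s < v ] co s s ≡ 2 * (r * c)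
    ∑-co-diag = begin
      ∑[ s < v ] co s s                       ≡⟨ sum-cong-≗ (λ s → trans (co-occurrence-diag (inRow d) (inCol d) s)
                                                                      (sym (cong₂ _+_ (occ≡row-degree s) (occ≡col-degree s)))) ⟩
      ∑[ s < v ] (occ d s + occ d s)          ≡⟨ ∑-distrib-+ (occ d) (occ d) ⟩
      ∑[ s < v ] occ d s + ∑[ s < v ] occ d s ≡⟨ cong₂ _+_ ∑-occ (trans ∑-occ (sym (+-identityʳ (r * c)))) ⟩
      2 * (r * c)                             ∎

-- The parameters as averages

≥2-nonZero : ∀ {k} → 2 ≤ k → NonZero k
≥2-nonZero (s≤s _) = _

C2-nonZero : ∀ {k} → 2 ≤ k → NonZero (k C 2)
C2-nonZero {suc (suc k)} (s≤s (s≤s _)) = subst NonZero (sym (suc-C2 (suc k))) _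

pred-nonZero : ∀ {k} → 2 ≤ k → NonZero (k ∸ 1)
pred-nonZero (s≤s (s≤s _)) = _

module ParameterIdentities {r c v : ℕ} (2≤r : 2 ≤ r) (2≤c : 2 ≤ c) (2≤v : 2 ≤ v)
                           (d : Design r c v) (binary : Binary d) (equireplicate : EqOrNearEq d) where

  open BinaryDesign d binary

  private instance
    r≢0 = ≥2-nonZero 2≤r
    c≢0 = ≥2-nonZero 2≤c
    v≢0 = ≥2-nonZero 2≤v
    rc≢0 = m*n≢0 r c
    r-1≢0 = pred-nonZero 2≤r
    c-1≢0 = pred-nonZero 2≤c
    v-1≢0 = pred-nonZero 2≤v

  private
    e = eP r c v
    ae = (r * c) / v

    ceiling-e : ∃[ be ] ceiling e ≡ + be
    ceiling-e with ceiling-divℕ (r * c) v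
    ... | inj₁ (_ , ⌈e⌉≡ae) = ae , ⌈e⌉≡ae
    ... | inj₂ ⌈e⌉≡ae+1     = suc ae , ⌈e⌉≡ae+1

    ∑occ²-at-two-values : ∀ be → ceiling e ≡ + be → Σocc² + v * (ae * be) ≡ (ae + be) * (r * c)
    ∑occ²-at-two-values be ⌈e⌉≡be = begin
      Σocc² + v * (ae * be)                    ≡⟨ cong (λ y → Σocc² + y) (∑-const v (ae * be)) ⟨
      Σocc² + ∑[ s < v ] (ae * be)             ≡⟨ ∑-distrib-+ (λ s → occ d s * occ d s) (λ _ → ae * be) ⟨
      ∑[ s < v ] (occ d s * occ d s + ae * be) ≡⟨ sum-cong-≗ (λ s → at-two-values (occ-values s)) ⟩
      ∑[ s < v ] ((ae + be) * occ d s)         ≡⟨ *-distribˡ-sum (ae + be) (occ d) ⟨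
      (ae + be) * ∑[ s < v ] occ d s           ≡⟨ cong ((ae + be) *_) ∑-occ ⟩
      (ae + be) * (r * c)                      ∎
      where
      occ-values : ∀ s → occ d s ≡ ae ⊎ occ d s ≡ be
      occ-values s with equireplicate s
      ... | inj₁ occ≡⌊e⌋ = inj₁ (ℤ.+-injective (trans occ≡⌊e⌋ (floor-divℕ (r * c) v)))
      ... | inj₂ occ≡⌈e⌉ = inj₂ (ℤ.+-injective (trans occ≡⌈e⌉ ⌈e⌉≡be))
      at-two-values : ∀ {x} → x ≡ ae ⊎ x ≡ be → x * x + ae * be ≡ (ae + be) * x
      at-two-values (inj₁ refl) = left ae be
        where
        left : ∀ a b → a * a + a * b ≡ (a + b) * a
        left = solve-∀
      at-two-values (inj₂ refl) = right ae be
        where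
        right : ∀ a b → b * b + a * b ≡ (a + b) * b
        right = solve-∀

  λrc≡avg : λrcP r c v ≡ divℕ (+ Σocc²) (r * c)
  λrc≡avg with ceiling-e
  ... | be , ⌈e⌉≡be = divℕ-unique Σocc² (r * c) (begin
    ρ ℚ.* λrcP r c v
      ≡⟨ cong₂ (λ x y → ρ ℚ.* (x ℚ.+ y ℚ.- x ℚ.* y ℚ.* w)) (cong (ℚ._/ 1) (floor-divℕ (r * c) v)) (cong (ℚ._/ 1) ⌈e⌉≡be) ⟩
    ρ ℚ.* (α ℚ.+ β ℚ.- α ℚ.* β ℚ.* w)
      ≡⟨ expand ρ α β w ⟩
    (α ℚ.+ β) ℚ.* ρ ℚ.- α ℚ.* β ℚ.* (ρ ℚ.* w)
      ≡⟨ cong (λ y → (α ℚ.+ β) ℚ.* ρ ℚ.- α ℚ.* β ℚ.* y) (ℕtoℚ-*-divℕ v (r * c)) ⟩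
    (α ℚ.+ β) ℚ.* ρ ℚ.- α ℚ.* β ℚ.* ℕtoℚ v
      ≡⟨ cong (λ y → y ℚ.- α ℚ.* β ℚ.* ℕtoℚ v) ℕtoℚ[Σ+vab] ⟨
    (ℕtoℚ Σocc² ℚ.+ ℕtoℚ v ℚ.* (α ℚ.* β)) ℚ.- α ℚ.* β ℚ.* ℕtoℚ v
      ≡⟨ cancel (ℕtoℚ Σocc²) (ℕtoℚ v) α β ⟩
    ℕtoℚ Σocc² ∎)
    where
    open +-*-Solver
    ρ = ℕtoℚ (r * c)
    α = ℕtoℚ ae
    β = ℕtoℚ be
    w = divℕ (+ v) (r * c)
    ℕtoℚ[Σ+vab] : ℕtoℚ Σocc² ℚ.+ ℕtoℚ v ℚ.* (α ℚ.* β) ≡ (α ℚ.+ β) ℚ.* ρ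
    ℕtoℚ[Σ+vab] = begin
      ℕtoℚ Σocc² ℚ.+ ℕtoℚ v ℚ.* (α ℚ.* β)      ≡⟨ cong (λ y → ℕtoℚ Σocc² ℚ.+ ℕtoℚ v ℚ.* y) (ℕtoℚ-* ae be) ⟨
      ℕtoℚ Σocc² ℚ.+ ℕtoℚ v ℚ.* ℕtoℚ (ae * be) ≡⟨ cong (ℕtoℚ Σocc² ℚ.+_) (ℕtoℚ-* v (ae * be)) ⟨
      ℕtoℚ Σocc² ℚ.+ ℕtoℚ (v * (ae * be))      ≡⟨ ℕtoℚ-+ Σocc² (v * (ae * be)) ⟨
      ℕtoℚ (Σocc² + v * (ae * be))             ≡⟨ cong ℕtoℚ (∑occ²-at-two-values be ⌈e⌉≡be) ⟩
      ℕtoℚ ((ae + be) * (r * c))               ≡⟨ trans (ℕtoℚ-* (ae + be) (r * c)) (cong (ℚ._* ρ) (ℕtoℚ-+ ae be)) ⟩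
      (α ℚ.+ β) ℚ.* ρ                          ∎
    expand : ∀ ρ α β w → ρ ℚ.* (α ℚ.+ β ℚ.- α ℚ.* β ℚ.* w) ≡ (α ℚ.+ β) ℚ.* ρ ℚ.- α ℚ.* β ℚ.* (ρ ℚ.* w)
    expand = solve 4 (λ ρ α β w → ρ :* (α :+ β :- α :* β :* w) := (α :+ β) :* ρ :- α :* β :* (ρ :* w)) refl
    cancel : ∀ σ ν α β → (σ ℚ.+ ν ℚ.* (α ℚ.* β)) ℚ.- α ℚ.* β ℚ.* ν ≡ σ
    cancel = solve 4 (λ σ ν α β → (σ :+ ν :* (α :* β)) :- α :* β :* ν := σ) refl

  private
    half-difference : ∀ {P K T} → P ≡ K + 2 * T → (ℕtoℚ P ℚ.- ℕtoℚ K) ℚ.* ½ ≡ ℕtoℚ T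
    half-difference {P} {K} {T} refl = begin
      (ℕtoℚ (K + 2 * T) ℚ.- ℕtoℚ K) ℚ.* ½
        ≡⟨ cong (λ y → (ℕtoℚ (K + y) ℚ.- ℕtoℚ K) ℚ.* ½) (cong (λ y → T + y) (+-identityʳ T)) ⟩
      (ℕtoℚ (K + (T + T)) ℚ.- ℕtoℚ K) ℚ.* ½
        ≡⟨ cong (λ y → (y ℚ.- ℕtoℚ K) ℚ.* ½) (trans (ℕtoℚ-+ K (T + T)) (cong (ℕtoℚ K ℚ.+_) (ℕtoℚ-+ T T))) ⟩
      (ℕtoℚ K ℚ.+ (ℕtoℚ T ℚ.+ ℕtoℚ T) ℚ.- ℕtoℚ K) ℚ.* ½
        ≡⟨ halve (ℕtoℚ K) (ℕtoℚ T) ⟩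
      ℕtoℚ T ∎
      where
      open +-*-Solver
      halve : ∀ κ τ → (κ ℚ.+ (τ ℚ.+ τ) ℚ.- κ) ℚ.* ½ ≡ τ
      halve = solve 2 (λ κ τ → (κ :+ (τ :+ τ) :- κ) :* con ½ := τ) refl

    ℕtoℚ-*-λrc : ℕtoℚ (r * c) ℚ.* λrcP r c v ≡ ℕtoℚ Σocc²
    ℕtoℚ-*-λrc = trans (cong (ℕtoℚ (r * c) ℚ.*_) λrc≡avg) (ℕtoℚ-*-divℕ Σocc² (r * c))

    pair-average : ∀ k l T .{{_ : NonZero (k ∸ 1)}} → k * l ≡ r * c → Σocc² ≡ k * l + 2 * T →
                   ℕtoℚ (k C 2) ℚ.* (ℕtoℚ l ℚ.* (λrcP r c v ℚ.- 1ℚ) ℚ.* divℕ (+ 1) (k ∸ 1)) ≡ ℕtoℚ T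
    pair-average k l T kl≡rc Σ≡kl+2T = begin
      ℕtoℚ (k C 2) ℚ.* (ℕtoℚ l ℚ.* (λrc ℚ.- 1ℚ) ℚ.* divℕ (+ 1) (k ∸ 1))
        ≡⟨ ℕtoℚ-C2-*-divℕ-pred k (ℕtoℚ l ℚ.* (λrc ℚ.- 1ℚ)) ⟩
      ℕtoℚ k ℚ.* (ℕtoℚ l ℚ.* (λrc ℚ.- 1ℚ)) ℚ.* ½
        ≡⟨ expand (ℕtoℚ k) (ℕtoℚ l) λrc ⟩
      (ℕtoℚ k ℚ.* ℕtoℚ l ℚ.* λrc ℚ.- ℕtoℚ k ℚ.* ℕtoℚ l) ℚ.* ½
        ≡⟨ cong (λ y → (y ℚ.* λrc ℚ.- y) ℚ.* ½) (trans (sym (ℕtoℚ-* k l)) (cong ℕtoℚ kl≡rc)) ⟩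
      (ℕtoℚ (r * c) ℚ.* λrc ℚ.- ℕtoℚ (r * c)) ℚ.* ½
        ≡⟨ cong (λ y → (y ℚ.- ℕtoℚ (r * c)) ℚ.* ½) ℕtoℚ-*-λrc ⟩
      (ℕtoℚ Σocc² ℚ.- ℕtoℚ (r * c)) ℚ.* ½
        ≡⟨ half-difference {K = r * c} {T} (trans Σ≡kl+2T (cong (_+ 2 * T) kl≡rc)) ⟩
      ℕtoℚ T ∎
      where
      open +-*-Solver
      λrc = λrcP r c v
      expand : ∀ κ ι x → κ ℚ.* (ι ℚ.* (x ℚ.- 1ℚ)) ℚ.* ½ ≡ (κ ℚ.* ι ℚ.* x ℚ.- κ ℚ.* ι) ℚ.* ½
      expand = solve 3 (λ κ ι x → κ :* (ι :* (x :- con 1ℚ)) :* con ½ := (κ :* ι :* x :- κ :* ι) :* con ½) refl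

  λrr≡avg : λrrP r c v ≡ divℕ (+ ∑⟨ ascending ⟩ (rrI d)) (r C 2)
  λrr≡avg = divℕ-unique (∑⟨ ascending ⟩ (rrI d)) (r C 2) {{C2-nonZero 2≤r}}
                        (pair-average r c (∑⟨ ascending ⟩ (rrI d)) refl Σocc²≡rc+2∑rrI)

  λcc≡avg : λccP r c v ≡ divℕ (+ ∑⟨ ascending ⟩ (ccI d)) (c C 2)
  λcc≡avg = divℕ-unique (∑⟨ ascending ⟩ (ccI d)) (c C 2) {{C2-nonZero 2≤c}}
                        (pair-average c r (∑⟨ ascending ⟩ (ccI d)) (*-comm c r) Σocc²≡cr+2∑ccI)

  μ≡avg : μP r c v ≡ divℕ (+ ∑⟨ ascending ⟩ (co-occurrence (inRow d) (inCol d))) (v C 2)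
  μ≡avg = divℕ-unique Tμ (v C 2) {{C2-nonZero 2≤v}} (begin
    ℕtoℚ (v C 2) ℚ.* (e ℚ.* γ ℚ.* divℕ (+ 1) (v ∸ 1)) ≡⟨ ℕtoℚ-C2-*-divℕ-pred v (e ℚ.* γ) ⟩
    ℕtoℚ v ℚ.* (e ℚ.* γ) ℚ.* ½                        ≡⟨ cong (ℚ._* ½) (ℚ.*-assoc (ℕtoℚ v) e γ) ⟨
    ℕtoℚ v ℚ.* e ℚ.* γ ℚ.* ½                          ≡⟨ cong (λ y → y ℚ.* γ ℚ.* ½) (ℕtoℚ-*-divℕ (r * c) v) ⟩
    ℕtoℚ (r * c) ℚ.* γ ℚ.* ½                          ≡⟨ cong (ℚ._* ½) (ℕtoℚ-* (r * c) G) ⟨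
    ℕtoℚ (r * c * G) ℚ.* ½                            ≡⟨ cong (ℚ._* ½) (ℚ.+-identityʳ (ℕtoℚ (r * c * G))) ⟨
    (ℕtoℚ (r * c * G) ℚ.- ℕtoℚ 0) ℚ.* ½               ≡⟨ half-difference {K = 0} {Tμ} rcG≡2Tμ ⟩
    ℕtoℚ Tμ                                           ∎)
    where
    Tμ = ∑⟨ ascending ⟩ (co-occurrence (inRow d) (inCol d))
    G = r + c ∸ 2
    γ = ℕtoℚ G
    rcG≡2Tμ : r * c * G ≡ 2 * Tμ
    rcG≡2Tμ = +-cancelʳ-≡ (2 * (r * c)) _ _ (begin
      r * c * G + 2 * (r * c)   ≡⟨ factor (r * c) G ⟩
      r * c * (G + 2)           ≡⟨ cong (r * c *_) (m∸n+n≡m (≤-trans 2≤r (m≤m+n r c))) ⟩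
      r * c * (r + c)           ≡⟨ expand r c ⟩
      r * (c * c) + c * (r * r) ≡⟨ rcc+crr≡2rc+2∑co ⟩
      2 * (r * c) + 2 * Tμ      ≡⟨ +-comm (2 * (r * c)) (2 * Tμ) ⟩
      2 * Tμ + 2 * (r * c)      ∎)
      where
      factor : ∀ x g → x * g + 2 * x ≡ x * (g + 2)
      factor = solve-∀
      expand : ∀ r c → r * c * (r + c) ≡ r * (c * c) + c * (r * r)
      expand = solve-∀

module _ {n : ℕ} (f : Fin n → Fin n → ℕ) (f-sym : ∀ i j → f i j ≡ f j i) .{{_ : NonZero (n C 2)}} where

  minΣC2-pairs-≡⇔ : minΣC2 (n C 2) (∑⟨ ascending ⟩ f) ≡ ∑⟨ ascending ⟩ (λ i j → f i j C 2)
                    ⇔ (∀ i j → i ≢ j → FloorOrCeiling (f i j) (divℕ (+ ∑⟨ ascending ⟩ f) (n C 2)))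
  minΣC2-pairs-≡⇔ = mk⇔ (AllOn-ascending⇒≢ (λ i j → subst (λ x → FloorOrCeiling x q) (f-sym i j))) ≢⇒AllOn-ascending
                    ⇔-∘ minΣC2-≡⇔FloorOrCeiling ascending f (∑⟨ascending⟩-1≡C2 n)
    where
    q = divℕ (+ ∑⟨ ascending ⟩ f) (n C 2)

module CoincidenceBounds {r c v : ℕ} (2≤r : 2 ≤ r) (2≤c : 2 ≤ c) (2≤v : 2 ≤ v)
                         (d : Design r c v) (binary : Binary d) (equireplicate : EqOrNearEq d) where

  open BinaryDesign d binary
  open ParameterIdentities 2≤r 2≤c 2≤v d binary equireplicate

  private instance
    rC2≢0 = C2-nonZero 2≤r
    cC2≢0 = C2-nonZero 2≤c
    vC2≢0 = C2-nonZero 2≤v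
    rc≢0  = m*n≢0 r c {{≥2-nonZero 2≤r}} {{≥2-nonZero 2≤c}}

  -- Definitionally the count of rows and columns containing s and t in NearBalancedGrid.
  μ : Fin v → Fin v → ℕ
  μ = co-occurrence (inRow d) (inCol d)

  coincidences : ℕ
  coincidences = ∑⟨ ascending ⟩ (λ s t → μ s t C 2)

  minNTA minNBG : ℕ
  minNTA = minΣC2 (c C 2) (∑⟨ ascending ⟩ (ccI d)) + minΣC2 (r C 2) (∑⟨ ascending ⟩ (rrI d)) + minΣC2 (r * c) (∑⟨ full ⟩ (rcI d))
  minNBG = minΣC2 (v C 2) (∑⟨ ascending ⟩ μ)

  S-NTA≡minNTA : S-NTA r c v ≡ ℕtoℚ minNTA
  S-NTA≡minNTA = begin
    S-NTA r c v
      ≡⟨ cong₂ ℚ._+_ (cong₂ ℚ._+_ (cong (S (c C 2)) λcc≡avg) (cong (S (r C 2)) λrr≡avg))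
                   (cong (S (r * c)) (trans λrc≡avg (cong (λ t → divℕ (+ t) (r * c)) (sym ∑∑-rcI)))) ⟩
    S (c C 2) (divℕ (+ ∑⟨ ascending ⟩ (ccI d)) (c C 2)) ℚ.+ S (r C 2) (divℕ (+ ∑⟨ ascending ⟩ (rrI d)) (r C 2))
      ℚ.+ S (r * c) (divℕ (+ ∑⟨ full ⟩ (rcI d)) (r * c))
      ≡⟨ cong₂ ℚ._+_ (cong₂ ℚ._+_ (S-divℕ (c C 2) Tcc) (S-divℕ (r C 2) Trr)) (S-divℕ (r * c) Trc) ⟩
    ℕtoℚ m₁ ℚ.+ ℕtoℚ m₂ ℚ.+ ℕtoℚ m₃
      ≡⟨ trans (ℕtoℚ-+ (m₁ + m₂) m₃) (cong (ℚ._+ ℕtoℚ m₃) (ℕtoℚ-+ m₁ m₂)) ⟨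
    ℕtoℚ minNTA ∎
    where
    Tcc = ∑⟨ ascending ⟩ (ccI d)
    Trr = ∑⟨ ascending ⟩ (rrI d)
    Trc = ∑⟨ full ⟩ (rcI d)
    m₁ = minΣC2 (c C 2) Tcc
    m₂ = minΣC2 (r C 2) Trr
    m₃ = minΣC2 (r * c) Trc

  S-NBG≡minNBG : S-NBG r c v ≡ ℕtoℚ minNBG
  S-NBG≡minNBG = trans (cong (S (v C 2)) μ≡avg) (S-divℕ (v C 2) (∑⟨ ascending ⟩ μ))

  private
    Yrr Ycc Yrc : ℕ
    Yrr = ∑⟨ ascending ⟩ (λ i i' → rrI d i i' C 2)
    Ycc = ∑⟨ ascending ⟩ (λ j j' → ccI d j j' C 2)
    Yrc = ∑⟨ full ⟩ (λ i j → rcI d i j C 2)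

    coincidences≡ : coincidences ≡ Ycc + Yrr + Yrc
    coincidences≡ = trans (pair-double-counting (inRow d) (inCol d)) (cong (_+ Yrc) (+-comm Yrr Ycc))

    ccI≤ : minΣC2 (c C 2) (∑⟨ ascending ⟩ (ccI d)) ≤ Ycc
    ccI≤ = minΣC2-≤ ascending (ccI d) (∑⟨ascending⟩-1≡C2 c)
    rrI≤ : minΣC2 (r C 2) (∑⟨ ascending ⟩ (rrI d)) ≤ Yrr
    rrI≤ = minΣC2-≤ ascending (rrI d) (∑⟨ascending⟩-1≡C2 r)
    rcI≤ : minΣC2 (r * c) (∑⟨ full ⟩ (rcI d)) ≤ Yrc
    rcI≤ = minΣC2-≤ full (rcI d) (∑⟨full⟩-1 r c)

  minNTA≤coincidences : minNTA ≤ coincidences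
  minNTA≤coincidences = ≤-trans (+-mono-≤ (+-mono-≤ ccI≤ rrI≤) rcI≤) (≤-reflexive (sym coincidences≡))

  minNBG≤coincidences : minNBG ≤ coincidences
  minNBG≤coincidences = minΣC2-≤ ascending μ (∑⟨ascending⟩-1≡C2 v)

  TripleArrayCondition : Set
  TripleArrayCondition = (∀ i j → InFloorCeil d (rcI d i j) (avgRC d))
                      × (∀ i i' → i ≢ i' → InFloorCeil d (rrI d i i') (avgRR d))
                      × (∀ j j' → j ≢ j' → InFloorCeil d (ccI d j j') (avgCC d))

  BalancedGridCondition : Set
  BalancedGridCondition = ∀ s t → s ≢ t → InFloorCeil d (μ s t) (μP r c v)

  private
    rc-tight⇔ : minΣC2 (r * c) (∑⟨ full ⟩ (rcI d)) ≡ Yrc ⇔ (∀ i j → InFloorCeil d (rcI d i j) (avgRC d))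
    rc-tight⇔ = subst (λ q → minΣC2 (r * c) (∑⟨ full ⟩ (rcI d)) ≡ Yrc ⇔ (∀ i j → FloorOrCeiling (rcI d i j) q))
                      (cong (λ t → divℕ (+ t) (r * c)) (sym (sumF²≡∑∑ (rcI d))))
                      (mk⇔ (λ h i j → h i j _) (λ h i j _ → h i j) ⇔-∘ minΣC2-≡⇔FloorOrCeiling full (rcI d) (∑⟨full⟩-1 r c))

    rr-tight⇔ : minΣC2 (r C 2) (∑⟨ ascending ⟩ (rrI d)) ≡ Yrr ⇔ (∀ i i' → i ≢ i' → InFloorCeil d (rrI d i i') (avgRR d))
    rr-tight⇔ = subst (λ q → minΣC2 (r C 2) (∑⟨ ascending ⟩ (rrI d)) ≡ Yrr ⇔ (∀ i i' → i ≢ i' → FloorOrCeiling (rrI d i i') q))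
                      (cong (λ t → divℕ (+ t) (r C 2)) (sym (sumF²≡∑∑ (restrict ascending (rrI d)))))
                      (minΣC2-pairs-≡⇔ (rrI d) (meet-comm (inRow d) (inRow d)))

    cc-tight⇔ : minΣC2 (c C 2) (∑⟨ ascending ⟩ (ccI d)) ≡ Ycc ⇔ (∀ j j' → j ≢ j' → InFloorCeil d (ccI d j j') (avgCC d))
    cc-tight⇔ = subst (λ q → minΣC2 (c C 2) (∑⟨ ascending ⟩ (ccI d)) ≡ Ycc ⇔ (∀ j j' → j ≢ j' → FloorOrCeiling (ccI d j j') q))
                      (cong (λ t → divℕ (+ t) (c C 2)) (sym (sumF²≡∑∑ (restrict ascending (ccI d)))))
                      (minΣC2-pairs-≡⇔ (ccI d) (meet-comm (inCol d) (inCol d)))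

  minNTA≡coincidences⇔ : minNTA ≡ coincidences ⇔ TripleArrayCondition
  minNTA≡coincidences⇔ = mk⇔ tight⇒condition condition⇒tight
    where
    open Equivalence
    tight⇒condition : minNTA ≡ coincidences → TripleArrayCondition
    tight⇒condition eq = to rc-tight⇔ (proj₂ cc+rr|rc) , to rr-tight⇔ (proj₂ cc|rr) , to cc-tight⇔ (proj₁ cc|rr)
      where
      cc+rr|rc : minΣC2 (c C 2) (∑⟨ ascending ⟩ (ccI d)) + minΣC2 (r C 2) (∑⟨ ascending ⟩ (rrI d)) ≡ Ycc + Yrr
                 × minΣC2 (r * c) (∑⟨ full ⟩ (rcI d)) ≡ Yrc
      cc+rr|rc = +-mono-≤-≡⇒≡ (+-mono-≤ ccI≤ rrI≤) rcI≤ (trans eq coincidences≡)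
      cc|rr : minΣC2 (c C 2) (∑⟨ ascending ⟩ (ccI d)) ≡ Ycc × minΣC2 (r C 2) (∑⟨ ascending ⟩ (rrI d)) ≡ Yrr
      cc|rr = +-mono-≤-≡⇒≡ ccI≤ rrI≤ (proj₁ cc+rr|rc)
    condition⇒tight : TripleArrayCondition → minNTA ≡ coincidences
    condition⇒tight (rc , rr , cc) =
      trans (cong₂ _+_ (cong₂ _+_ (from cc-tight⇔ cc) (from rr-tight⇔ rr)) (from rc-tight⇔ rc)) (sym coincidences≡)

  minNBG≡coincidences⇔ : minNBG ≡ coincidences ⇔ BalancedGridCondition
  minNBG≡coincidences⇔ = subst (λ q → minNBG ≡ coincidences ⇔ (∀ s t → s ≢ t → FloorOrCeiling (μ s t) q)) (sym μ≡avg)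
                                (minΣC2-pairs-≡⇔ μ (co-occurrence-sym (inRow d) (inCol d)))

  minNTA≡minNBG : S-NTA r c v ≡ S-NBG r c v → minNTA ≡ minNBG
  minNTA≡minNBG S≡ = ℕtoℚ-injective (trans (sym S-NTA≡minNTA) (trans S≡ S-NBG≡minNBG))

theorem7p1 : (r c v : ℕ) → 2 ≤ r → 2 ≤ c → 2 ≤ v →
      (S-NTA r c v < S-NBG r c v → ¬ ∃ (λ (d : Design r c v) → NearTripleArray d))
    × (S-NBG r c v < S-NTA r c v → ¬ ∃ (λ (d : Design r c v) → NearBalancedGrid d))
    × (S-NTA r c v ≡ S-NBG r c v →
         (d : Design r c v) → (NearTripleArray d → NearBalancedGrid d) × (NearBalancedGrid d → NearTripleArray d))
theorem7p1 r c v 2≤r 2≤c 2≤v = no-NTA , no-NBG , NTA⇔NBG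
  where
  open Equivalence
  module B = CoincidenceBounds 2≤r 2≤c 2≤v

  no-NTA : S-NTA r c v < S-NBG r c v → ¬ ∃ (λ (d : Design r c v) → NearTripleArray d)
  no-NTA S< (d , binary , eqn , condition) =
    <⇒≱ (ℕtoℚ-cancel-< (subst₂ _<_ S-NTA≡minNTA S-NBG≡minNBG S<))
        (subst (minNBG ≤_) (sym (from minNTA≡coincidences⇔ condition)) minNBG≤coincidences)
    where open B d binary eqn

  no-NBG : S-NBG r c v < S-NTA r c v → ¬ ∃ (λ (d : Design r c v) → NearBalancedGrid d)
  no-NBG S< (d , binary , eqn , condition) =
    <⇒≱ (ℕtoℚ-cancel-< (subst₂ _<_ S-NBG≡minNBG S-NTA≡minNTA S<))
        (subst (minNTA ≤_) (sym (from minNBG≡coincidences⇔ condition)) minNTA≤coincidences)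
    where open B d binary eqn

  NTA⇔NBG : S-NTA r c v ≡ S-NBG r c v → (d : Design r c v) →
            (NearTripleArray d → NearBalancedGrid d) × (NearBalancedGrid d → NearTripleArray d)
  NTA⇔NBG S≡ d = (λ (binary , eqn , condition) → let open B d binary eqn in
                    binary , eqn , to minNBG≡coincidences⇔ (trans (sym (minNTA≡minNBG S≡)) (from minNTA≡coincidences⇔ condition)))
               , (λ (binary , eqn , condition) → let open B d binary eqn in
                    binary , eqn , to minNTA≡coincidences⇔ (trans (minNTA≡minNBG S≡) (from minNBG≡coincidences⇔ condition)))
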